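{- For all integers $n\ge 0$ and all integers $k\ge j\ge 0$, \[ a_{9(k-j)+4,\;9k+2}(9n+7)\equiv 0 \pmod 3. \]
   Context: For positive integers $r,s$, $a_{r,s}(n)$ denotes the number of multicolored partitions of $n$ in which each even part may appear in one of $r$ colors and each odd part may appear in one of $s$ colors (copies of the same part size in different colors are distinct), with $a_{r,s}(0)=1$. Equivalently, for $|q|<1$, $\sum_{n\ge0}a_{r,s}(n)q^n = f_2^{s-r}/f_1^{s}$, where $f_m=\prod_{i\ge1}(1-q^{mi})$. -}

module Defs where

open import Data.Nat using (ℕ; zero; suc; _+_; _*_; _∸_; _≤ᵇ_)
open import Data.Nat.Base using (_%_)
open import Data.Bool using (Bool; true; false; if_then_else_)
open import Data.List using (List; []; _∷_; map; upTo; replicate; concatMap)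
open import Data.Nat.ListAction using (sum)

isEven : ℕ → Bool
isEven zero = true
isEven (suc zero) = false
isEven (suc (suc n)) = isEven n

colours : ℕ → ℕ → ℕ → ℕ
colours r s m = if isEven m then r else s

-- The "coloured part types" that can occur in a partition of n:
-- each part size m ∈ {1,…,n} listed once per available colour.
partTypes : ℕ → ℕ → ℕ → List ℕ
partTypes r s n = concatMap (λ m → replicate (colours r s m) m) (map suc (upTo n))

-- countReps ts n = number of ways to choose a multiplicity kᵢ ≥ 0 for each
-- entry tᵢ of ts (entries are distinct coloured part types) so that
-- Σ kᵢ·tᵢ = n.  (Multiplicity k ranges over 0..n with k·t ≤ n.)
countReps : List ℕ → ℕ → ℕ
countReps [] zero = 1
countReps [] (suc _) = 0
countReps (t ∷ ts) n =
  sum (map (λ k → if k * t ≤ᵇ n then countReps ts (n ∸ k * t) else 0) (upTo (suc n)))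

-- a r s n : number of multicoloured partitions of n in which each even part
-- may appear in one of r colours and each odd part in one of s colours.
-- a r s 0 = 1.
a : ℕ → ℕ → ℕ → ℕ
a r s n = countReps (partTypes r s n) n

-- Work in F₃[[q]]. There the generating function f₂^(9j-2) / f₁^(9k+2) is a series in q⁹
-- times 1 / (f₁² f₂²) = φ(-q)² / f₃², where φ(-q) = f₁² / f₂ and f₁⁶ = f₃² (Frobenius), so it
-- suffices that the coefficients of q^(9n+7) in φ(-q)² / f₃² vanish. Jacobi's triple product,
-- proved from its finite form in which the Gaussian binomials [2n choose j] tend to 1 / f_c,
-- gives the 3-dissection φ(-q) = Θ(9,9) + q Θ(15,3) with Θ(9,9) a series in q⁹ and Θ(15,3) one
-- in q³. In the square only the cross term 2q Θ(9,9) Θ(15,3) / f₃² reaches exponents ≡ 7 (mod 9),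
-- and by the triple product again Θ(15,3) / f₃² = φ(-q³) V with V a series in q⁹; since φ(-q³)
-- only has exponents 3k², never ≡ 6 (mod 9), the cross term vanishes there too.

module Submission where

open import Defs
open import Data.Nat using (ℕ; _+_; _*_; _∸_; _≤_)
open import Data.Nat.Divisibility using (_∣_)

module 𝔽₃ where

  open import Algebra.Bundles using (CommutativeRing)
  open import Algebra.Structures using (IsCommutativeRing)
  open import Data.Fin using (Fin; zero; suc; toℕ)
  open import Data.Fin.Properties public using (_≟_)
  open import Data.Fin.Properties using (all?; toℕ-fromℕ<; fromℕ<-cong)
  open import Data.Maybe as Maybe using (Maybe)
  open import Data.Nat as ℕ using (ℕ)
  open import Data.Nat.DivMod using (_mod_; m%n<n; %-distribˡ-+)
  open import Data.Nat.Divisibility using (_∣_; m%n≡0⇒n∣m)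
  open import Data.Product using (_,_)
  open import Level using (0ℓ)
  open import Relation.Binary.PropositionalEquality
    using (_≡_; sym; trans; cong; cong₂; isEquivalence; module ≡-Reasoning)
  open import Relation.Nullary.Decidable using (from-yes; dec⇒maybe)
  open import Tactic.RingSolver.Core.AlmostCommutativeRing
    using (AlmostCommutativeRing; fromCommutativeRing)

  F3 : Set
  F3 = Fin 3

  0F 1F : F3
  0F = zero
  1F = suc zero

  infix  8 -F_
  infixl 6 _+F_
  infixl 7 _*F_

  -- Defined by cases rather than through _mod_, so that terms with variables stay neutral for the ring solvers.
  succ : F3 → F3
  succ zero             = suc zero
  succ (suc zero)       = suc (suc zero)
  succ (suc (suc zero)) = zero

  -F_ : F3 → F3
  -F zero           = zero
  -F suc zero       = suc (suc zero)
  -F suc (suc zero) = suc zero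

  _+F_ _*F_ : F3 → F3 → F3
  zero           +F y = y
  suc zero       +F y = succ y
  suc (suc zero) +F y = succ (succ y)

  zero           *F y = zero
  suc zero       *F y = y
  suc (suc zero) *F y = -F y

  isCommutativeRing : IsCommutativeRing _≡_ _+F_ _*F_ -F_ 0F 1F
  isCommutativeRing = record
    { isRing = record
      { +-isAbelianGroup = record
        { isGroup = record
          { isMonoid = record
            { isSemigroup = record
              { isMagma = record { isEquivalence = isEquivalence ; ∙-cong = cong₂ _+F_ }
              ; assoc = from-yes (all? λ x → all? λ y → all? λ z → (x +F y) +F z ≟ x +F (y +F z)) }
            ; identity = from-yes (all? λ x → 0F +F x ≟ x) , from-yes (all? λ x → x +F 0F ≟ x) }
          ; inverse = from-yes (all? λ x → -F x +F x ≟ 0F) , from-yes (all? λ x → x +F -F x ≟ 0F)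
          ; ⁻¹-cong = cong -F_ }
        ; comm = from-yes (all? λ x → all? λ y → x +F y ≟ y +F x) }
      ; *-cong = cong₂ _*F_
      ; *-assoc = from-yes (all? λ x → all? λ y → all? λ z → (x *F y) *F z ≟ x *F (y *F z))
      ; *-identity = from-yes (all? λ x → 1F *F x ≟ x) , from-yes (all? λ x → x *F 1F ≟ x)
      ; distrib = from-yes (all? λ x → all? λ y → all? λ z → x *F (y +F z) ≟ x *F y +F x *F z)
                , from-yes (all? λ x → all? λ y → all? λ z → (y +F z) *F x ≟ y *F x +F z *F x) }
    ; *-comm = from-yes (all? λ x → all? λ y → x *F y ≟ y *F x) }

  mod3-+ : ∀ m n → (m ℕ.+ n) mod 3 ≡ m mod 3 +F n mod 3
  mod3-+ m n = begin
    (m ℕ.+ n) mod 3                           ≡⟨ fromℕ<-cong _ _ (%-distribˡ-+ m n 3) _ _ ⟩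
    (m ℕ.% 3 ℕ.+ n ℕ.% 3) mod 3              ≡⟨ cong₂ (λ a b → (a ℕ.+ b) mod 3) (toℕ-mod m) (toℕ-mod n) ⟨
    (toℕ (m mod 3) ℕ.+ toℕ (n mod 3)) mod 3  ≡⟨ +-via-mod (m mod 3) (n mod 3) ⟨
    m mod 3 +F n mod 3                         ∎
    where
    open ≡-Reasoning
    toℕ-mod : ∀ m → toℕ (m mod 3) ≡ m ℕ.% 3
    toℕ-mod m = toℕ-fromℕ< (m%n<n m 3)
    +-via-mod : ∀ x y → x +F y ≡ (toℕ x ℕ.+ toℕ y) mod 3
    +-via-mod = from-yes (all? λ x → all? λ y → x +F y ≟ (toℕ x ℕ.+ toℕ y) mod 3)

  commutativeRing : CommutativeRing 0ℓ 0ℓ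
  commutativeRing = record { isCommutativeRing = isCommutativeRing }

  open CommutativeRing commutativeRing public using (rawRing)

  ring : AlmostCommutativeRing 0ℓ 0ℓ
  ring = fromCommutativeRing commutativeRing λ x → Maybe.map sym (dec⇒maybe (x ≟ 0F))

  mod3≡0⇒3∣ : ∀ n → n mod 3 ≡ 0F → 3 ∣ n
  mod3≡0⇒3∣ n eq = m%n≡0⇒n∣m n 3 (trans (sym (toℕ-fromℕ< (m%n<n n 3))) (cong toℕ eq))

module PowerSeries where

  open import Algebra.Bundles using (CommutativeRing)
  open import Algebra.Solver.Ring.AlmostCommutativeRing using (_-Raw-AlmostCommutative⟶_; fromCommutativeRing)
  open import Algebra.Structures using (IsCommutativeRing)
  open import Data.Maybe as Maybe using (Maybe)
  open import Data.Nat as ℕ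
    using (ℕ; zero; suc; _≤_; _<_; _∸_; _%_; z≤n; s≤s; _≤?_; _≟_; NonZero; >-nonZero⁻¹)
  open import Data.Nat.DivMod using (m%n%n≡m%n; %-distribˡ-+; m<n⇒m%n≡m)
  open import Data.Nat.Divisibility using (_∣_; ∣-trans; m%n≡0⇒n∣m; n∣m⇒m%n≡0)
  open import Data.Nat.Properties
    using (*-zeroʳ; *-suc; m+[n∸m]≡n; m∸n+n≡m; m∸n≤m; ≤-trans; <-≤-trans; ≰⇒>; m≤m+n)
  open import Data.Product using (_,_)
  open import Function using (_∘_)
  open import Level using (0ℓ)
  open import Relation.Binary.PropositionalEquality
    using (_≡_; _≢_; refl; sym; trans; cong; cong₂; module ≡-Reasoning)
  open import Relation.Nullary using (yes; no; contradiction)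
  open import Relation.Nullary.Decidable using (dec⇒maybe)
  open import Tactic.RingSolver using (solve-∀)
  import Relation.Binary.Reasoning.Setoid

  open 𝔽₃ public using (F3; 0F; 1F; _+F_; _*F_; -F_)
  open CommutativeRing 𝔽₃.commutativeRing public using ()
    renaming ( +-assoc to +F-assoc; +-comm to +F-comm; +-identityˡ to +F-identityˡ; +-identityʳ to +F-identityʳ
             ; -‿inverseˡ to -F-inverseˡ; -‿inverseʳ to -F-inverseʳ
             ; *-assoc to *F-assoc; *-comm to *F-comm; *-identityˡ to *F-identityˡ
             ; zeroˡ to *F-zeroˡ; zeroʳ to *F-zeroʳ; distribʳ to *F-distribʳ)

  -F-involutive : ∀ x → -F -F x ≡ x
  -F-involutive = solve-∀ 𝔽₃.ring

  Series : Set
  Series = ℕ → F3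

  infix  4 _≈_
  infix  8 ⊖_
  infixl 6 _⊕_ _⊝_
  infixl 7 _⊛_ _·_

  _≈_ : Series → Series → Set
  f ≈ g = ∀ n → f n ≡ g n

  _⊕_ : Series → Series → Series
  (f ⊕ g) n = f n +F g n

  ⊖_ : Series → Series
  (⊖ f) n = -F f n

  _⊝_ : Series → Series → Series
  f ⊝ g = f ⊕ ⊖ g

  _·_ : F3 → Series → Series
  (c · f) n = c *F f n

  𝟘 : Series
  𝟘 _ = 0F

  const : F3 → Series
  const c zero    = c
  const c (suc _) = 0F

  𝟙 : Series
  𝟙 = const 1F

  tail : Series → Series
  tail f n = f (suc n)

  -- The Cauchy product, unfolded along the first factor: f g = f₀ g + q (tail f) g.
  _⊛_ : Series → Series → Series
  (f ⊛ g) zero    = f 0 *F g 0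
  (f ⊛ g) (suc n) = f 0 *F g (suc n) +F (tail f ⊛ g) n

  ⊛-coeff-cong : ∀ n f g f′ g′ → (∀ i → i ≤ n → f i *F g (n ∸ i) ≡ f′ i *F g′ (n ∸ i)) →
                 (f ⊛ g) n ≡ (f′ ⊛ g′) n
  ⊛-coeff-cong zero    f g f′ g′ h = h 0 z≤n
  ⊛-coeff-cong (suc n) f g f′ g′ h =
    cong₂ _+F_ (h 0 z≤n) (⊛-coeff-cong n (tail f) g (tail f′) g′ λ i i≤n → h (suc i) (s≤s i≤n))

  ⊛-cong : ∀ {f f′ g g′} → f ≈ f′ → g ≈ g′ → f ⊛ g ≈ f′ ⊛ g′
  ⊛-cong {f} {f′} {g} {g′} p q n = ⊛-coeff-cong n f g f′ g′ λ i _ → cong₂ _*F_ (p i) (q (n ∸ i))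

  ⊛-zeroˡ : ∀ h → 𝟘 ⊛ h ≈ 𝟘
  ⊛-zeroˡ h zero    = *F-zeroˡ (h 0)
  ⊛-zeroˡ h (suc n) = trans (cong₂ _+F_ (*F-zeroˡ (h (suc n))) (⊛-zeroˡ h n)) refl

  ⊛-distribʳ : ∀ h f g → (f ⊕ g) ⊛ h ≈ f ⊛ h ⊕ g ⊛ h
  ⊛-distribʳ h f g zero    = *F-distribʳ (h 0) (f 0) (g 0)
  ⊛-distribʳ h f g (suc n) =
    trans (cong₂ _+F_ (*F-distribʳ (h (suc n)) (f 0) (g 0)) (⊛-distribʳ h (tail f) (tail g) n))
          (interchange (f 0 *F h (suc n)) (g 0 *F h (suc n)) ((tail f ⊛ h) n) ((tail g ⊛ h) n))
    where
    interchange : ∀ a b c d → (a +F b) +F (c +F d) ≡ (a +F c) +F (b +F d)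
    interchange = solve-∀ 𝔽₃.ring

  ⊛-scalarˡ : ∀ c f h → (c · f) ⊛ h ≈ c · (f ⊛ h)
  ⊛-scalarˡ c f h zero    = *F-assoc c (f 0) (h 0)
  ⊛-scalarˡ c f h (suc n) = trans (cong ((c *F f 0) *F h (suc n) +F_) (⊛-scalarˡ c (tail f) h n))
                                  (factor c (f 0) (h (suc n)) ((tail f ⊛ h) n))
    where
    factor : ∀ c a b d → (c *F a) *F b +F c *F d ≡ c *F (a *F b +F d)
    factor = solve-∀ 𝔽₃.ring

  ⊛-identityˡ : ∀ h → 𝟙 ⊛ h ≈ h
  ⊛-identityˡ h zero    = *F-identityˡ (h 0)
  ⊛-identityˡ h (suc n) = trans (cong₂ _+F_ (*F-identityˡ (h (suc n))) (⊛-zeroˡ h n)) (+F-identityʳ _)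

  ⊛-swap : ∀ n f g → (f ⊛ tail g) n +F f (suc n) *F g 0 ≡ (tail f ⊛ g) n +F f 0 *F g (suc n)
  ⊛-swap zero    f g = +F-comm (f 0 *F g 1) (f 1 *F g 0)
  ⊛-swap (suc n) f g =
    trans (+F-assoc (f 0 *F g (2 ℕ.+ n)) _ _)
          (trans (cong (f 0 *F g (2 ℕ.+ n) +F_) (⊛-swap n (tail f) g))
                 (rotate (f 0 *F g (2 ℕ.+ n)) ((tail (tail f) ⊛ g) n) (f 1 *F g (suc n))))
    where
    rotate : ∀ a b c → a +F (b +F c) ≡ c +F b +F a
    rotate = solve-∀ 𝔽₃.ring

  ⊛-comm : ∀ f g → f ⊛ g ≈ g ⊛ f
  ⊛-comm f g zero    = *F-comm (f 0) (g 0)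
  ⊛-comm f g (suc n) =
    trans (+F-comm (f 0 *F g (suc n)) _)
    (trans (sym (⊛-swap n f g))
    (trans (cong₂ _+F_ (⊛-comm f (tail g) n) (*F-comm (f (suc n)) (g 0)))
           (+F-comm _ (g 0 *F f (suc n)))))

  ⊛-assoc : ∀ f g h → (f ⊛ g) ⊛ h ≈ f ⊛ (g ⊛ h)
  ⊛-assoc f g h zero    = *F-assoc (f 0) (g 0) (h 0)
  ⊛-assoc f g h (suc n) =
    trans (cong ((f 0 *F g 0) *F h (suc n) +F_)
            (trans (⊛-distribʳ h (f 0 · tail g) (tail f ⊛ g) n)
                   (cong₂ _+F_ (⊛-scalarˡ (f 0) (tail g) h n) (⊛-assoc (tail f) g h n))))
          (regroup (f 0) (g 0) (h (suc n)) ((tail g ⊛ h) n) ((tail f ⊛ (g ⊛ h)) n))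
    where
    regroup : ∀ a b c d e → (a *F b) *F c +F (a *F d +F e) ≡ a *F (b *F c +F d) +F e
    regroup = solve-∀ 𝔽₃.ring

  isCommutativeRing : IsCommutativeRing _≈_ _⊕_ _⊛_ ⊖_ 𝟘 𝟙
  isCommutativeRing = record
    { isRing = record
      { +-isAbelianGroup = record
        { isGroup = record
          { isMonoid = record
            { isSemigroup = record
              { isMagma = record
                { isEquivalence = record
                  { refl = λ _ → refl ; sym = λ p n → sym (p n) ; trans = λ p q n → trans (p n) (q n) }
                ; ∙-cong = λ p q n → cong₂ _+F_ (p n) (q n) }
              ; assoc = λ f g h n → +F-assoc (f n) (g n) (h n) }
            ; identity = (λ f n → +F-identityˡ (f n)) , (λ f n → +F-identityʳ (f n)) }
          ; inverse = (λ f n → -F-inverseˡ (f n)) , (λ f n → -F-inverseʳ (f n))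
          ; ⁻¹-cong = λ p n → cong -F_ (p n) }
        ; comm = λ f g n → +F-comm (f n) (g n) }
      ; *-cong = ⊛-cong
      ; *-assoc = ⊛-assoc
      ; *-identity = ⊛-identityˡ , λ h n → trans (⊛-comm h 𝟙 n) (⊛-identityˡ h n)
      ; distrib = (λ h f g n → trans (⊛-comm h (f ⊕ g) n)
                                (trans (⊛-distribʳ h f g n) (cong₂ _+F_ (⊛-comm f h n) (⊛-comm g h n))))
                , ⊛-distribʳ }
    ; *-comm = ⊛-comm }

  commutativeRing : CommutativeRing 0ℓ 0ℓ
  commutativeRing = record { isCommutativeRing = isCommutativeRing }

  const-* : ∀ c d → const (c *F d) ≈ const c ⊛ const d
  const-* c d zero    = refl
  const-* c d (suc n) = sym (trans (cong (_+F (tail (const c) ⊛ const d) n) (*F-zeroʳ c)) (⊛-zeroˡ (const d) n))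

  const-⊖ : ∀ c → const (-F c) ≈ ⊖ const c
  const-⊖ c zero    = refl
  const-⊖ c (suc n) = refl

  const-⊛ : ∀ c f n → (const c ⊛ f) n ≡ c *F f n
  const-⊛ c f zero    = refl
  const-⊛ c f (suc n) = trans (cong (c *F f (suc n) +F_) (⊛-zeroˡ f n)) (+F-identityʳ (c *F f (suc n)))

  const-hom : 𝔽₃.rawRing -Raw-AlmostCommutative⟶ fromCommutativeRing commutativeRing
  const-hom = record
    { ⟦_⟧    = const
    ; +-homo = λ c d → λ { zero → refl ; (suc n) → refl }
    ; *-homo = const-*
    ; -‿homo = const-⊖
    ; 0-homo = λ { zero → refl ; (suc n) → refl }
    ; 1-homo = λ { zero → refl ; (suc n) → refl } }

  const-≟ : ∀ c d → Maybe (const c ≈ const d)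
  const-≟ c d = Maybe.map (λ c≡d n → cong (λ x → const x n) c≡d) (dec⇒maybe (c 𝔽₃.≟ d))

  -- Coefficients are normalised in F3 rather than in Series, so the solver also proves identities such as
  -- (1 - x)³ = 1 - x³ that hold only in characteristic 3.
  open import Algebra.Solver.Ring 𝔽₃.rawRing (fromCommutativeRing commutativeRing) const-hom const-≟ public
    using (solve; _:=_; _:+_; _:*_; _:-_; :-_; con)

  open CommutativeRing commutativeRing public
    using (setoid; commutativeSemiring)
    renaming ( sym to ≈-sym; +-cong to ⊕-cong; -‿cong to ⊖-cong
             ; *-identityʳ to ⊛-identityʳ; zeroʳ to ⊛-zeroʳ; distribˡ to ⊛-distribˡ)

  module ≈-Reasoning = Relation.Binary.Reasoning.Setoid setoid

  ⊛-congˡ : ∀ f {g g′} → g ≈ g′ → f ⊛ g ≈ f ⊛ g′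
  ⊛-congˡ f g≈g′ = ⊛-cong {f} {f} (λ _ → refl) g≈g′

  ⊛-congʳ : ∀ g {f f′} → f ≈ f′ → f ⊛ g ≈ f′ ⊛ g
  ⊛-congʳ g f≈f′ = ⊛-cong {g = g} {g} f≈f′ (λ _ → refl)

  ⊕-congˡ : ∀ f {g g′} → g ≈ g′ → f ⊕ g ≈ f ⊕ g′
  ⊕-congˡ f g≈g′ n = cong (f n +F_) (g≈g′ n)

  ⊕-congʳ : ∀ g {f f′} → f ≈ f′ → f ⊕ g ≈ f′ ⊕ g
  ⊕-congʳ g f≈f′ n = cong (_+F g n) (f≈f′ n)

  ⊛-vanishesˡ : ∀ {f} g → f ≈ 𝟘 → f ⊛ g ≈ 𝟘
  ⊛-vanishesˡ g f≈0 n = trans (⊛-congʳ g f≈0 n) (⊛-zeroˡ g n)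

  ⊛-vanishesʳ : ∀ f {g} → g ≈ 𝟘 → f ⊛ g ≈ 𝟘
  ⊛-vanishesʳ f g≈0 n = trans (⊛-congˡ f g≈0 n) (⊛-zeroʳ f n)

  both-𝟘 : ∀ {f g} → f ≈ 𝟘 → g ≈ 𝟘 → f ≈ g
  both-𝟘 f≈0 g≈0 n = trans (f≈0 n) (sym (g≈0 n))

  open import Algebra.Properties.CommutativeSemiring.Exp commutativeSemiring public
    using (_^_; ^-homo-*; ^-assocʳ; ^-distrib-*; ^-congˡ)

  infix 9 q^_

  q^_ : ℕ → Series
  (q^ zero)  zero    = 1F
  (q^ zero)  (suc n) = 0F
  (q^ suc k) zero    = 0F
  (q^ suc k) (suc n) = (q^ k) n

  q^0 : q^ 0 ≈ 𝟙
  q^0 zero    = refl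
  q^0 (suc n) = refl

  q^-< : ∀ {k n} → n < k → (q^ k) n ≡ 0F
  q^-< {suc k} {zero}  _         = refl
  q^-< {suc k} {suc n} (s≤s n<k) = q^-< n<k

  q^-≢ : ∀ {k n} → n ≢ k → (q^ k) n ≡ 0F
  q^-≢ {zero}  {zero}  n≢k = contradiction refl n≢k
  q^-≢ {zero}  {suc n} _   = refl
  q^-≢ {suc k} {zero}  _   = refl
  q^-≢ {suc k} {suc n} n≢k = q^-≢ (n≢k ∘ cong suc)

  q^⊛-+ : ∀ k f n → (q^ k ⊛ f) (k ℕ.+ n) ≡ f n
  q^⊛-+ zero    f n = trans (⊛-cong q^0 (λ _ → refl) n) (⊛-identityˡ f n)
  q^⊛-+ (suc k) f n = q^⊛-+ k f n

  q^⊛-< : ∀ k f {n} → n < k → (q^ k ⊛ f) n ≡ 0F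
  q^⊛-< (suc k) f {zero}  _         = *F-zeroˡ (f 0)
  q^⊛-< (suc k) f {suc n} (s≤s n<k) = trans (cong₂ _+F_ (*F-zeroˡ (f (suc n))) (q^⊛-< k f n<k)) (+F-identityˡ 0F)

  q^⊛-≥ : ∀ k f {n} → k ≤ n → (q^ k ⊛ f) n ≡ f (n ∸ k)
  q^⊛-≥ k f {n} k≤n = trans (cong (q^ k ⊛ f) (sym (m+[n∸m]≡n k≤n))) (q^⊛-+ k f (n ∸ k))

  q^-+ : ∀ a b → q^ (a ℕ.+ b) ≈ q^ a ⊛ q^ b
  q^-+ a b n with a ≤? n
  ... | yes a≤n = sym (trans (q^⊛-≥ a (q^ b) a≤n)
                        (trans (shift a (n ∸ a)) (cong (q^ (a ℕ.+ b)) (m+[n∸m]≡n a≤n))))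
    where
    shift : ∀ a m → (q^ b) m ≡ (q^ (a ℕ.+ b)) (a ℕ.+ m)
    shift zero    m = refl
    shift (suc a) m = shift a m
  ... | no  a≰n = trans (q^-< (<-≤-trans (≰⇒> a≰n) (m≤m+n a b))) (sym (q^⊛-< a (q^ b) (≰⇒> a≰n)))

  q^-^ : ∀ m k → (q^ m) ^ k ≈ q^ (m ℕ.* k)
  q^-^ m zero    n = sym (trans (cong (λ e → (q^ e) n) (*-zeroʳ m)) (q^0 n))
  q^-^ m (suc k) n = trans (⊛-congˡ (q^ m) (q^-^ m k) n)
    (trans (sym (q^-+ m (m ℕ.* k) n)) (cong (λ e → (q^ e) n) (sym (*-suc m k))))

  infix 4 _≈[_]_

  _≈[_]_ : Series → ℕ → Series → Set
  f ≈[ n ] g = ∀ i → i ≤ n → f i ≡ g i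

  ≈⇒≈[] : ∀ {f g n} → f ≈ g → f ≈[ n ] g
  ≈⇒≈[] f≈g i _ = f≈g i

  ≈[]-sym : ∀ {f g n} → f ≈[ n ] g → g ≈[ n ] f
  ≈[]-sym f≈g i i≤n = sym (f≈g i i≤n)

  ≈[]-trans : ∀ {f g h n} → f ≈[ n ] g → g ≈[ n ] h → f ≈[ n ] h
  ≈[]-trans f≈g g≈h i i≤n = trans (f≈g i i≤n) (g≈h i i≤n)

  ≈[]-weaken : ∀ {f g m n} → m ≤ n → f ≈[ n ] g → f ≈[ m ] g
  ≈[]-weaken m≤n f≈g i i≤m = f≈g i (≤-trans i≤m m≤n)

  ⊛-cong-≈[] : ∀ {n f f′ g g′} → f ≈[ n ] f′ → g ≈[ n ] g′ → f ⊛ g ≈[ n ] f′ ⊛ g′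
  ⊛-cong-≈[] {n} {f} {f′} {g} {g′} f≈f′ g≈g′ i i≤n = ⊛-coeff-cong i f g f′ g′ λ j j≤i →
    cong₂ _*F_ (f≈f′ j (≤-trans j≤i i≤n)) (g≈g′ (i ∸ j) (≤-trans (m∸n≤m i j) i≤n))

  ^-cong-≈[] : ∀ {n f g} k → f ≈[ n ] g → f ^ k ≈[ n ] g ^ k
  ^-cong-≈[] zero    f≈g = λ _ _ → refl
  ^-cong-≈[] (suc k) f≈g = ⊛-cong-≈[] f≈g (^-cong-≈[] k f≈g)

  Supported : (d : ℕ) → .{{NonZero d}} → Series → Set
  Supported d f = ∀ n → n % d ≢ 0 → f n ≡ 0F

  VanishesOn : (d : ℕ) → .{{NonZero d}} → ℕ → Series → Set
  VanishesOn d r f = ∀ n → n % d ≡ r → f n ≡ 0F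

  module _ (d : ℕ) .{{_ : NonZero d}} where

    ⊛-vanishesOn : ∀ {r f g} → VanishesOn d r f → Supported d g → VanishesOn d r (f ⊛ g)
    ⊛-vanishesOn {r} {f} {g} f-vanishes g-supported n n≡r =
      trans (⊛-coeff-cong n f g 𝟘 g term) (⊛-zeroˡ g n)
      where
      term : ∀ i → i ≤ n → f i *F g (n ∸ i) ≡ 0F *F g (n ∸ i)
      term i i≤n with (n ∸ i) % d ≟ 0
      ... | yes n∸i≡0 = cong (_*F g (n ∸ i)) (f-vanishes i (trans residue n≡r))
        where
        residue : i % d ≡ n % d
        residue = begin
          i % d                           ≡⟨ m%n%n≡m%n i d ⟨
          (0 ℕ.+ i % d) % d               ≡⟨ cong (λ x → (x ℕ.+ i % d) % d) n∸i≡0 ⟨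
          ((n ∸ i) % d ℕ.+ i % d) % d     ≡⟨ %-distribˡ-+ (n ∸ i) i d ⟨
          (n ∸ i ℕ.+ i) % d               ≡⟨ cong (_% d) (m∸n+n≡m i≤n) ⟩
          n % d                           ∎
          where open ≡-Reasoning
      ... | no  n∸i≢0 = trans (cong (f i *F_) (g-supported (n ∸ i) n∸i≢0))
                              (trans (*F-zeroʳ (f i)) (sym (*F-zeroˡ (g (n ∸ i)))))

    ⊛-supported : ∀ {f g} → Supported d f → Supported d g → Supported d (f ⊛ g)
    ⊛-supported {f} f-supported g-supported n n≢0 =
      ⊛-vanishesOn (λ i i≡n → f-supported i (n≢0 ∘ trans (sym i≡n))) g-supported n refl

    supported-cong : ∀ {f g} → f ≈ g → Supported d f → Supported d g
    supported-cong f≈g f-supported n n≢0 = trans (sym (f≈g n)) (f-supported n n≢0)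

    𝟙-supported : Supported d 𝟙
    𝟙-supported zero    0≢0 = contradiction (m<n⇒m%n≡m (>-nonZero⁻¹ d)) 0≢0
    𝟙-supported (suc n) _   = refl

    ^-supported : ∀ {f} k → Supported d f → Supported d (f ^ k)
    ^-supported zero    _           = 𝟙-supported
    ^-supported (suc k) f-supported = ⊛-supported f-supported (^-supported k f-supported)

    q^-supported : ∀ {k} → k % d ≡ 0 → Supported d (q^ k)
    q^-supported k≡0 n n≢0 = q^-≢ λ n≡k → n≢0 (trans (cong (_% d) n≡k) k≡0)

  supported-∣ : ∀ {d e} .{{_ : NonZero d}} .{{_ : NonZero e}} {f} → d ∣ e → Supported e f → Supported d f
  supported-∣ {d} {e} d∣e f-supported n n%d≢0 =
    f-supported n λ n%e≡0 → n%d≢0 (n∣m⇒m%n≡0 n d (∣-trans d∣e (m%n≡0⇒n∣m n e n%e≡0)))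

module SeriesSums where

  open import Data.Nat as ℕ using (ℕ; zero; suc; _+_; _*_; _∸_; _≤_; _<_; z≤n; s≤s)
  open import Data.Nat.Properties using (*-suc; m+[n∸m]≡n; n≤1+n; m≤n*m)
  open import Function using (_∘_)
  open import Relation.Binary.PropositionalEquality
    using (_≡_; refl; sym; trans; cong; cong₂; module ≡-Reasoning)

  open PowerSeries

  ∑< : (ℕ → Series) → ℕ → Series
  ∑< u zero    = 𝟘
  ∑< u (suc L) = u 0 ⊕ ∑< (u ∘ suc) L

  ∑<-cong-at : ∀ u v L {i j} → (∀ k → k < L → u k i ≡ v k j) → ∑< u L i ≡ ∑< v L j
  ∑<-cong-at u v zero    u≡v = refl
  ∑<-cong-at u v (suc L) u≡v =
    cong₂ _+F_ (u≡v 0 (s≤s z≤n)) (∑<-cong-at (u ∘ suc) (v ∘ suc) L λ k k<L → u≡v (suc k) (s≤s k<L))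

  ∑<-cong : ∀ {u v} L → (∀ k → u k ≈ v k) → ∑< u L ≈ ∑< v L
  ∑<-cong {u} {v} L u≈v i = ∑<-cong-at u v L λ k _ → u≈v k i

  ∑<-cong-≈[] : ∀ {u v M} L → (∀ k → k < L → u k ≈[ M ] v k) → ∑< u L ≈[ M ] ∑< v L
  ∑<-cong-≈[] {u} {v} L u≈v i i≤M = ∑<-cong-at u v L λ k k<L → u≈v k k<L i i≤M

  ∑<-extend-at : ∀ u L K i → (∀ k → L ≤ k → u k i ≡ 0F) → ∑< u (L + K) i ≡ ∑< u L i
  ∑<-extend-at u zero    zero    i u≡0 = refl
  ∑<-extend-at u zero    (suc K) i u≡0 =
    trans (cong₂ _+F_ (u≡0 0 z≤n) (∑<-extend-at (u ∘ suc) zero K i λ k _ → u≡0 (suc k) z≤n)) (+F-identityʳ 0F)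
  ∑<-extend-at u (suc L) K       i u≡0 =
    cong (u 0 i +F_) (∑<-extend-at (u ∘ suc) L K i λ k L≤k → u≡0 (suc k) (s≤s L≤k))

  ∑<-extend : ∀ u L K → (∀ k → L ≤ k → u k ≈ 𝟘) → ∑< u (L + K) ≈ ∑< u L
  ∑<-extend u L K u≈0 i = ∑<-extend-at u L K i λ k L≤k → u≈0 k L≤k i

  ∑<-⊕ : ∀ u v L → ∑< (λ k → u k ⊕ v k) L ≈ ∑< u L ⊕ ∑< v L
  ∑<-⊕ u v zero    i = sym (+F-identityʳ 0F)
  ∑<-⊕ u v (suc L) i = trans (cong ((u 0 ⊕ v 0) i +F_) (∑<-⊕ (u ∘ suc) (v ∘ suc) L i))
    (solve 4 (λ a b c d → (a :+ b) :+ (c :+ d) := (a :+ c) :+ (b :+ d)) (λ _ → refl)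
           (u 0) (v 0) (∑< (u ∘ suc) L) (∑< (v ∘ suc) L) i)

  ∑<-⊛ : ∀ g u L → ∑< (λ k → g ⊛ u k) L ≈ g ⊛ ∑< u L
  ∑<-⊛ g u zero    i = sym (⊛-zeroʳ g i)
  ∑<-⊛ g u (suc L) i = trans (cong ((g ⊛ u 0) i +F_) (∑<-⊛ g (u ∘ suc) L i))
                              (sym (⊛-distribˡ g (u 0) (∑< (u ∘ suc) L) i))

  ∑<-last : ∀ u L → ∑< u (suc L) ≈ ∑< u L ⊕ u L
  ∑<-last u zero    i = trans (+F-identityʳ (u 0 i)) (sym (+F-identityˡ (u 0 i)))
  ∑<-last u (suc L) i = trans (cong (u 0 i +F_) (∑<-last (u ∘ suc) L i)) (sym (+F-assoc (u 0 i) _ _))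

  ∑<-+ : ∀ u m L → ∑< u (m + L) ≈ ∑< u m ⊕ ∑< (u ∘ (m +_)) L
  ∑<-+ u zero    L i = sym (+F-identityˡ _)
  ∑<-+ u (suc m) L i = trans (cong (u 0 i +F_) (∑<-+ (u ∘ suc) m L i)) (sym (+F-assoc (u 0 i) _ _))

  ∑<-reverse : ∀ u L → ∑< u L ≈ ∑< (λ k → u (L ∸ suc k)) L
  ∑<-reverse u zero    i = refl
  ∑<-reverse u (suc L) i = trans (∑<-last u L i) (trans (cong (_+F u L i) (∑<-reverse u L i)) (+F-comm _ (u L i)))

  ∑<-group3 : ∀ u L → ∑< u (3 * L) ≈ ∑< (λ t → u (3 * t) ⊕ u (1 + 3 * t) ⊕ u (2 + 3 * t)) L
  ∑<-group3 u zero    i = refl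
  ∑<-group3 u (suc L) i =
    trans (cong (λ m → ∑< u m i) (*-suc 3 L))
    (trans (sym (+F-assoc (u 0 i) (u 1 i) _))
    (trans (sym (+F-assoc (u 0 i +F u 1 i) (u 2 i) _))
           (cong ((u 0 ⊕ u 1 ⊕ u 2) i +F_)
                 (trans (∑<-group3 (u ∘ suc ∘ suc ∘ suc) L i) (∑<-cong L shift i)))))
    where
    shift : ∀ t → u (3 + 3 * t) ⊕ u (4 + 3 * t) ⊕ u (5 + 3 * t)
                ≈ u (3 * suc t) ⊕ u (1 + 3 * suc t) ⊕ u (2 + 3 * suc t)
    shift t i = cong₂ _+F_ (cong₂ _+F_ (at 3+3t≡3[1+t]) (at (cong suc 3+3t≡3[1+t]))) (at (cong (2 +_) 3+3t≡3[1+t]))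
      where
      at : ∀ {m m′} → m ≡ m′ → u m i ≡ u m′ i
      at = cong (λ m → u m i)
      3+3t≡3[1+t] : 3 + 3 * t ≡ 3 * suc t
      3+3t≡3[1+t] = sym (*-suc 3 t)

  Summable : (ℕ → Series) → Set
  Summable u = ∀ k n → n < k → u k n ≡ 0F

  -- For summable u the terms u k with k > n do not contribute to the coefficient of q^n.
  ∑ : (ℕ → Series) → Series
  ∑ u n = ∑< u (suc n) n

  ∑-∑< : ∀ {u} → Summable u → ∀ n L → n < L → ∑< u L n ≡ ∑ u n
  ∑-∑< {u} summable n L n<L =
    trans (cong (λ m → ∑< u m n) (sym (m+[n∸m]≡n n<L))) (∑<-extend-at u (suc n) (L ∸ suc n) n λ k → summable k n)

  ∑-cong : ∀ {u v} → (∀ k → u k ≈ v k) → ∑ u ≈ ∑ v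
  ∑-cong u≈v n = ∑<-cong (suc n) u≈v n

  ∑-⊕ : ∀ u v → ∑ (λ k → u k ⊕ v k) ≈ ∑ u ⊕ ∑ v
  ∑-⊕ u v n = ∑<-⊕ u v (suc n) n

  ∑-q : ∀ {u} → Summable u → ∑ (λ k → q^ 1 ⊛ u k) ≈ q^ 1 ⊛ ∑ u
  ∑-q {u} summable zero    = refl
  ∑-q {u} summable (suc n) = begin
    ∑< (λ k → q^ 1 ⊛ u k) (2 + n) (suc n)
      ≡⟨ ∑<-cong-at (λ k → q^ 1 ⊛ u k) u (2 + n) {suc n} (λ k _ → q^⊛-+ 1 (u k) n) ⟩
    ∑< u (2 + n) n
      ≡⟨ ∑-∑< summable n (2 + n) (s≤s (n≤1+n n)) ⟩
    ∑ u n
      ≡⟨ q^⊛-+ 1 (∑ u) n ⟨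
    (q^ 1 ⊛ ∑ u) (suc n) ∎
    where open ≡-Reasoning

  ∑-group3 : ∀ {u} → Summable u → ∑ u ≈ ∑ (λ t → u (3 * t) ⊕ u (1 + 3 * t) ⊕ u (2 + 3 * t))
  ∑-group3 {u} summable n =
    trans (sym (∑-∑< summable n (3 * suc n) (m≤n*m (suc n) 3))) (∑<-group3 u (suc n) n)

module EtaProducts where

  open import Data.Nat as ℕ
    using (ℕ; zero; suc; _+_; _*_; _≤_; _%_; z≤n; s≤s; _≤?_; _≟_; NonZero)
  open import Data.Nat.Properties
    using (+-comm; +-suc; +-identityʳ; *-suc; *-zeroʳ; ≤-refl; ≤-trans; ≤-pred; ≰⇒>; ≤∧≢⇒<; <⇒≢
          ; m≤n⇒m≤1+n; m≤n*m)
  open import Data.Nat.DivMod using (m<n⇒m%n≡m; m≤n⇒[n∸m]%m≡n%m)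
  open import Data.Nat.Divisibility using (∣-trans; m%n≡0⇒n∣m; n∣m⇒m%n≡0)
  open import Function using (_∘_)
  open import Relation.Binary.PropositionalEquality
    using (_≡_; _≢_; refl; sym; trans; cong; cong₂)
  open import Relation.Nullary using (yes; no; contradiction)

  open PowerSeries

  1-q^_ : ℕ → Series
  1-q^ m = 𝟙 ⊝ q^ m

  -- geom m = Σ_k q^(m k) = 1 / (1 - q^m) for m ≥ 1; the value at m = 0 is never used.
  geom : ℕ → Series
  geom zero      = 𝟙
  geom (suc m) n = 𝟙 (n % suc m)

  1-q^-⊛-geom : ∀ m → 1-q^ suc m ⊛ geom (suc m) ≈ 𝟙
  1-q^-⊛-geom m n = trans (expand n) (coefficient n)
    where
    M : ℕ
    M = suc m
    expand : 1-q^ M ⊛ geom M ≈ geom M ⊝ q^ M ⊛ geom M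
    expand = solve 2 (λ x g → (con 1F :- x) :* g := g :- x :* g) (λ _ → refl) (q^ M) (geom M)
    coefficient : ∀ n → geom M n +F -F (q^ M ⊛ geom M) n ≡ 𝟙 n
    coefficient n with M ≤? n
    ... | yes M≤n =
      trans (cong (λ x → geom M n +F -F x) (trans (q^⊛-≥ M (geom M) M≤n) (cong 𝟙 (m≤n⇒[n∸m]%m≡n%m M≤n))))
            (trans (-F-inverseʳ (geom M n)) (sym (𝟙-positive M≤n)))
      where
      𝟙-positive : ∀ {n} → M ≤ n → 𝟙 n ≡ 0F
      𝟙-positive (s≤s _) = refl
    ... | no  M≰n =
      trans (cong₂ (λ x y → x +F -F y) (cong 𝟙 (m<n⇒m%n≡m (≰⇒> M≰n))) (q^⊛-< M (geom M) (≰⇒> M≰n)))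
            (+F-identityʳ (𝟙 n))

  1-q^-≈[] : ∀ m → 1-q^ suc m ≈[ m ] 𝟙
  1-q^-≈[] m i i≤m = trans (cong (λ x → 𝟙 i +F -F x) (q^-< (s≤s i≤m))) (+F-identityʳ (𝟙 i))

  geom-≈[] : ∀ m → geom (suc m) ≈[ m ] 𝟙
  geom-≈[] m i i≤m = cong 𝟙 (m<n⇒m%n≡m (s≤s i≤m))

  factor : ℕ → ℕ → ℕ → Series
  factor j a b = (1-q^ j) ^ a ⊛ geom j ^ b

  𝟙^ : ∀ k → 𝟙 ^ k ≈ 𝟙
  𝟙^ zero    = λ _ → refl
  𝟙^ (suc k) = λ n → trans (⊛-identityˡ (𝟙 ^ k) n) (𝟙^ k n)

  factor-≈[] : ∀ m a b → factor (suc m) a b ≈[ m ] 𝟙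
  factor-≈[] m a b =
    ≈[]-trans (⊛-cong-≈[] (^-cong-≈[] a (1-q^-≈[] m)) (^-cong-≈[] b (geom-≈[] m)))
              (≈⇒≈[] λ n → trans (⊛-cong (𝟙^ a) (𝟙^ b) n) (⊛-identityˡ 𝟙 n))

  factor-⊛ : ∀ j a b a′ b′ → factor j a b ⊛ factor j a′ b′ ≈ factor j (a + a′) (b + b′)
  factor-⊛ j a b a′ b′ n = trans
    (solve 4 (λ x y z w → (x :* y) :* (z :* w) := (x :* z) :* (y :* w)) (λ _ → refl)
           ((1-q^ j) ^ a) (geom j ^ b) ((1-q^ j) ^ a′) (geom j ^ b′) n)
    (sym (⊛-cong (^-homo-* (1-q^ j) a a′) (^-homo-* (geom j) b b′) n))

  factor-cancel : ∀ m a b c → factor (suc m) (a + c) (b + c) ≈ factor (suc m) a b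
  factor-cancel m a b c n = trans (sym (factor-⊛ (suc m) a b c c n))
    (trans (⊛-congˡ (factor (suc m) a b) unit n) (⊛-identityʳ (factor (suc m) a b) n))
    where
    unit : factor (suc m) c c ≈ 𝟙
    unit n = trans (sym (^-distrib-* (1-q^ suc m) (geom (suc m)) c n))
                   (trans (^-congˡ c (1-q^-⊛-geom m) n) (𝟙^ c n))

  factor-cong : ∀ m a b a′ b′ → a + b′ ≡ a′ + b → factor (suc m) a b ≈ factor (suc m) a′ b′
  factor-cong m a b a′ b′ eq n = trans (sym (factor-cancel m a b b′ n))
    (trans (cong₂ (λ x y → factor (suc m) x y n) eq (+-comm b b′)) (factor-cancel m a′ b′ b n))

  factor-0-0 : ∀ j → factor j 0 0 ≈ 𝟙
  factor-0-0 j = ⊛-identityˡ 𝟙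

  1-q^-cube : ∀ m → (1-q^ m) ^ 3 ≈ 1-q^ (3 * m)
  1-q^-cube m n = trans
    (solve 1 (λ x → (con 1F :- x) :* ((con 1F :- x) :* ((con 1F :- x) :* con 1F)) := con 1F :- x :* (x :* x))
           (λ _ → refl) (q^ m) n)
    (cong (λ y → 𝟙 n +F -F y) (sym (trans (cong (λ k → (q^ k) n) (3*m≡m+[m+m] m))
                                           (trans (q^-+ m (m + m) n) (⊛-congˡ (q^ m) (q^-+ m m) n)))))
    where
    3*m≡m+[m+m] : ∀ m → 3 * m ≡ m + (m + m)
    3*m≡m+[m+m] m = cong (λ k → m + (m + k)) (+-identityʳ m)

  geom-cube : ∀ m → geom (suc m) ^ 3 ≈ geom (3 * suc m)
  geom-cube m = begin
    geom M ^ 3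
      ≈⟨ ⊛-identityˡ (geom M ^ 3) ⟨
    𝟙 ⊛ geom M ^ 3
      ≈⟨ ⊛-congʳ (geom M ^ 3) (inverse-comm (1-q^-⊛-geom (ℕ.pred (3 * M)))) ⟨
    (geom (3 * M) ⊛ 1-q^ (3 * M)) ⊛ geom M ^ 3
      ≈⟨ ⊛-assoc (geom (3 * M)) (1-q^ (3 * M)) (geom M ^ 3) ⟩
    geom (3 * M) ⊛ (1-q^ (3 * M) ⊛ geom M ^ 3)
      ≈⟨ ⊛-congˡ (geom (3 * M)) cube-inverse ⟩
    geom (3 * M) ⊛ 𝟙
      ≈⟨ ⊛-identityʳ (geom (3 * M)) ⟩
    geom (3 * M)                                ∎
    where
    open ≈-Reasoning
    M : ℕ
    M = suc m
    inverse-comm : ∀ {f g} → f ⊛ g ≈ 𝟙 → g ⊛ f ≈ 𝟙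
    inverse-comm {f} {g} fg≈𝟙 n = trans (⊛-comm g f n) (fg≈𝟙 n)
    cube-inverse : 1-q^ (3 * M) ⊛ geom M ^ 3 ≈ 𝟙
    cube-inverse n = trans (sym (⊛-congʳ (geom M ^ 3) (1-q^-cube M) n))
      (trans (sym (^-distrib-* (1-q^ M) (geom M) 3 n)) (trans (^-congˡ 3 (1-q^-⊛-geom m) n) (𝟙^ 3 n)))

  factor-frobenius : ∀ m a b → factor (suc m) (3 * a) (3 * b) ≈ factor (3 * suc m) a b
  factor-frobenius m a b = ⊛-cong (λ n → trans (sym (^-assocʳ (1-q^ suc m) 3 a n)) (^-congˡ a (1-q^-cube (suc m)) n))
                                  (λ n → trans (sym (^-assocʳ (geom (suc m)) 3 b n)) (^-congˡ b (geom-cube m) n))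

  module _ (d : ℕ) .{{_ : NonZero d}} where

    1-q^-supported : ∀ {m} → m % d ≡ 0 → Supported d (1-q^ m)
    1-q^-supported m≡0 n n≢0 =
      trans (cong₂ (λ x y → x +F -F y) (𝟙-supported d n n≢0) (q^-supported d m≡0 n n≢0)) (+F-identityʳ 0F)

    geom-supported : ∀ m → suc m % d ≡ 0 → Supported d (geom (suc m))
    geom-supported m sm≡0 n n≢0 with n % suc m ≟ 0
    ... | yes n≡0 =
      contradiction (n∣m⇒m%n≡0 n d (∣-trans (m%n≡0⇒n∣m (suc m) d sm≡0) (m%n≡0⇒n∣m n (suc m) n≡0))) n≢0
    ... | no  n≢0′ = 𝟙-positive n≢0′
      where
      𝟙-positive : ∀ {k} → k ≢ 0 → 𝟙 k ≡ 0F
      𝟙-positive {zero}  0≢0 = contradiction refl 0≢0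
      𝟙-positive {suc k} _   = refl

    factor-supported : ∀ m a b → suc m % d ≡ 0 → Supported d (factor (suc m) a b)
    factor-supported m a b sm≡0 =
      ⊛-supported d (^-supported d a (1-q^-supported sm≡0)) (^-supported d b (geom-supported m sm≡0))

  ∏≤ : (ℕ → Series) → ℕ → Series
  ∏≤ u zero    = 𝟙
  ∏≤ u (suc N) = ∏≤ u N ⊛ u (suc N)

  Converging : (ℕ → Series) → Set
  Converging u = ∀ m → u (suc m) ≈[ m ] 𝟙

  -- The infinite product of u 1, u 2, …; for converging u its coefficient of q^n is already that of ∏≤ u n.
  ∏ : (ℕ → Series) → Series
  ∏ u n = ∏≤ u n n

  ∏≤-stable : ∀ u → Converging u → ∀ {n} N → n ≤ N → ∏≤ u N ≈[ n ] ∏≤ u n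
  ∏≤-stable u conv zero z≤n = λ _ _ → refl
  ∏≤-stable u conv {n} (suc N) n≤1+N with n ≟ suc N
  ... | yes refl = λ _ _ → refl
  ... | no  n≢1+N = ≈[]-trans (⊛-cong-≈[] {f = ∏≤ u N} (λ _ _ → refl) (≈[]-weaken n≤N (conv N)))
                    (≈[]-trans (≈⇒≈[] (⊛-identityʳ (∏≤ u N))) (∏≤-stable u conv N n≤N))
    where n≤N = ≤-pred (≤∧≢⇒< n≤1+N n≢1+N)

  ∏-≈[] : ∀ u → Converging u → ∀ {n} N → n ≤ N → ∏ u ≈[ n ] ∏≤ u N
  ∏-≈[] u conv N n≤N i i≤n = sym (∏≤-stable u conv N (≤-trans i≤n n≤N) i ≤-refl)

  ∏≤-⊛ : ∀ u v N → ∏≤ (λ j → u j ⊛ v j) N ≈ ∏≤ u N ⊛ ∏≤ v N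
  ∏≤-⊛ u v zero    = λ n → sym (⊛-identityˡ 𝟙 n)
  ∏≤-⊛ u v (suc N) = λ n → trans (⊛-congʳ (u (suc N) ⊛ v (suc N)) (∏≤-⊛ u v N) n)
    (solve 4 (λ a b c d → (a :* b) :* (c :* d) := (a :* c) :* (b :* d)) (λ _ → refl)
           (∏≤ u N) (∏≤ v N) (u (suc N)) (v (suc N)) n)

  ∏-⊛ : ∀ u v → Converging u → Converging v → ∏ (λ j → u j ⊛ v j) ≈ ∏ u ⊛ ∏ v
  ∏-⊛ u v conv-u conv-v n = trans (∏≤-⊛ u v n n)
    (sym (⊛-cong-≈[] (∏-≈[] u conv-u n ≤-refl) (∏-≈[] v conv-v n ≤-refl) n ≤-refl))

  ∏≤-cong : ∀ {u v} → (∀ j → u (suc j) ≈ v (suc j)) → ∀ N → ∏≤ u N ≈ ∏≤ v N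
  ∏≤-cong u≈v zero    = λ _ → refl
  ∏≤-cong u≈v (suc N) = ⊛-cong (∏≤-cong u≈v N) (u≈v N)

  ∏-cong : ∀ {u v} → (∀ j → u (suc j) ≈ v (suc j)) → ∏ u ≈ ∏ v
  ∏-cong u≈v n = ∏≤-cong u≈v n n

  module _ (d : ℕ) .{{_ : NonZero d}} where

    ∏≤-supported : ∀ {u} → (∀ j → Supported d (u (suc j))) → ∀ N → Supported d (∏≤ u N)
    ∏≤-supported u-supported zero    = 𝟙-supported d
    ∏≤-supported u-supported (suc N) = ⊛-supported d (∏≤-supported u-supported N) (u-supported N)

    ∏-supported : ∀ {u} → (∀ j → Supported d (u (suc j))) → Supported d (∏ u)
    ∏-supported u-supported n = ∏≤-supported u-supported n n

  block : (ℕ → Series) → ℕ → ℕ → Series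
  block u A zero    = 𝟙
  block u A (suc d) = block u A d ⊛ u (A + suc d)

  ∏≤-+ : ∀ u A d → ∏≤ u (A + d) ≈ ∏≤ u A ⊛ block u A d
  ∏≤-+ u A zero    n = trans (cong (λ k → ∏≤ u k n) (+-identityʳ A)) (sym (⊛-identityʳ (∏≤ u A) n))
  ∏≤-+ u A (suc d) n = trans (cong (λ k → ∏≤ u k n) (+-suc A d))
    (trans (⊛-cong (∏≤-+ u A d) (λ i → cong (λ k → u k i) (sym (+-suc A d))) n)
           (⊛-assoc (∏≤ u A) (block u A d) (u (A + suc d)) n))

  ∏≤-blocks : ∀ {u w} d → (∀ i → block u (d * i) d ≈ w (suc i)) → ∀ N → ∏≤ u (d * N) ≈ ∏≤ w N
  ∏≤-blocks {u} d blocks zero    n = cong (λ k → ∏≤ u k n) (*-zeroʳ d)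
  ∏≤-blocks {u} d blocks (suc N) n =
    trans (cong (λ k → ∏≤ u k n) (trans (*-suc d N) (+-comm d (d * N))))
          (trans (∏≤-+ u (d * N) d n) (⊛-cong (∏≤-blocks d blocks N) (blocks N) n))

  ∏-blocks : ∀ u {w} d → .{{NonZero d}} → Converging u → (∀ i → block u (d * i) d ≈ w (suc i)) →
             ∏ u ≈ ∏ w
  ∏-blocks u d conv blocks n =
    trans (sym (∏≤-stable u conv (d * n) (m≤n*m n d) n ≤-refl)) (∏≤-blocks d blocks n n)

  block-⊛ : ∀ u v A d → block (λ j → u j ⊛ v j) A d ≈ block u A d ⊛ block v A d
  block-⊛ u v A zero    n = sym (⊛-identityˡ 𝟙 n)
  block-⊛ u v A (suc d) n = trans (⊛-congʳ (u (A + suc d) ⊛ v (A + suc d)) (block-⊛ u v A d) n)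
    (solve 4 (λ a b c d → (a :* b) :* (c :* d) := (a :* c) :* (b :* d)) (λ _ → refl)
           (block u A d) (block v A d) (u (A + suc d)) (v (A + suc d)) n)

  block-cong : ∀ {u v} A d → (∀ j → u j ≈ v j) → block u A d ≈ block v A d
  block-cong A zero    u≈v = λ _ → refl
  block-cong A (suc d) u≈v = ⊛-cong (block-cong A d u≈v) (u≈v (A + suc d))

  block-trivial : ∀ u A d → (∀ r → 1 ≤ r → r ≤ d → u (A + r) ≈ 𝟙) → block u A d ≈ 𝟙
  block-trivial u A zero    trivial = λ _ → refl
  block-trivial u A (suc d) trivial n =
    trans (⊛-cong (block-trivial u A d λ r 1≤r r≤d → trivial r 1≤r (m≤n⇒m≤1+n r≤d))
                  (trivial (suc d) (s≤s z≤n) ≤-refl) n)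
          (⊛-identityˡ 𝟙 n)

  block-single : ∀ u A d s → 1 ≤ s → s ≤ d → (∀ r → 1 ≤ r → r ≤ d → r ≢ s → u (A + r) ≈ 𝟙) →
                 block u A d ≈ u (A + s)
  block-single u A zero    (suc s) _ () _
  block-single u A (suc d) s 1≤s s≤1+d trivial n with s ≟ suc d
  ... | yes refl =
    trans (⊛-congʳ (u (A + suc d)) (block-trivial u A d λ r 1≤r r≤d →
                                      trivial r 1≤r (m≤n⇒m≤1+n r≤d) (<⇒≢ (s≤s r≤d))) n)
          (⊛-identityˡ (u (A + suc d)) n)
  ... | no  s≢1+d =
    trans (⊛-cong (block-single u A d s 1≤s (≤-pred (≤∧≢⇒< s≤1+d s≢1+d)) λ r 1≤r r≤d →
                     trivial r 1≤r (m≤n⇒m≤1+n r≤d))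
                  (trivial (suc d) (s≤s z≤n) ≤-refl (s≢1+d ∘ sym)) n)
          (⊛-identityʳ (u (A + s)) n)

  factors : (ℕ → ℕ) → (ℕ → ℕ) → ℕ → Series
  factors a b j = factor j (a j) (b j)

  Π : (ℕ → ℕ) → (ℕ → ℕ) → Series
  Π a b = ∏ (factors a b)

  factors-converge : ∀ a b → Converging (factors a b)
  factors-converge a b m = factor-≈[] m (a (suc m)) (b (suc m))

  Π-⊛ : ∀ a b a′ b′ → Π a b ⊛ Π a′ b′ ≈ Π (λ j → a j + a′ j) (λ j → b j + b′ j)
  Π-⊛ a b a′ b′ n =
    trans (sym (∏-⊛ (factors a b) (factors a′ b′) (factors-converge a b) (factors-converge a′ b′) n))
    (∏-cong (λ j → factor-⊛ (suc j) (a (suc j)) (b (suc j)) (a′ (suc j)) (b′ (suc j))) n)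

  Π-cong : ∀ a b a′ b′ → (∀ j → a (suc j) + b′ (suc j) ≡ a′ (suc j) + b (suc j)) → Π a b ≈ Π a′ b′
  Π-cong a b a′ b′ eq = ∏-cong {factors a b} {factors a′ b′} λ j →
    factor-cong j (a (suc j)) (b (suc j)) (a′ (suc j)) (b′ (suc j)) (eq j)

  Π-0-0 : Π (λ _ → 0) (λ _ → 0) ≈ 𝟙
  Π-0-0 n = ∏≤-trivial n n
    where
    ∏≤-trivial : ∀ N → ∏≤ (factors (λ _ → 0) (λ _ → 0)) N ≈ 𝟙
    ∏≤-trivial zero    = λ _ → refl
    ∏≤-trivial (suc N) = λ i → trans (⊛-cong (∏≤-trivial N) (factor-0-0 (suc N)) i) (⊛-identityˡ 𝟙 i)

  Π-supported : ∀ d .{{_ : NonZero d}} a b → (∀ j → Supported d (factor (suc j) (a (suc j)) (b (suc j)))) →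
                Supported d (Π a b)
  Π-supported d a b = ∏-supported d {factors a b}

  stretch₃ : (ℕ → ℕ) → ℕ → ℕ
  stretch₃ a zero                = a zero
  stretch₃ a (suc zero)          = 0
  stretch₃ a (suc (suc zero))    = 0
  stretch₃ a (suc (suc (suc j))) = stretch₃ (a ∘ suc) j

  stretch₃-3i : ∀ a i → stretch₃ a (3 * i) ≡ a i
  stretch₃-3i a zero    = refl
  stretch₃-3i a (suc i) = trans (cong (stretch₃ a) (*-suc 3 i)) (stretch₃-3i (a ∘ suc) i)

  stretch₃-3i+1 : ∀ a i → stretch₃ a (3 * i + 1) ≡ 0
  stretch₃-3i+1 a zero    = refl
  stretch₃-3i+1 a (suc i) = trans (cong (λ k → stretch₃ a (k + 1)) (*-suc 3 i)) (stretch₃-3i+1 (a ∘ suc) i)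

  stretch₃-3i+2 : ∀ a i → stretch₃ a (3 * i + 2) ≡ 0
  stretch₃-3i+2 a zero    = refl
  stretch₃-3i+2 a (suc i) = trans (cong (λ k → stretch₃ a (k + 2)) (*-suc 3 i)) (stretch₃-3i+2 (a ∘ suc) i)

  Π-frobenius : ∀ a b → Π (λ j → 3 * a j) (λ j → 3 * b j) ≈ Π (stretch₃ a) (stretch₃ b)
  Π-frobenius a b = ≈-sym (∏-blocks u 3 (factors-converge (stretch₃ a) (stretch₃ b)) blocks)
    where
    u : ℕ → Series
    u = factors (stretch₃ a) (stretch₃ b)
    blocks : ∀ i → block u (3 * i) 3 ≈ factor (suc i) (3 * a (suc i)) (3 * b (suc i))
    blocks i n = trans (block-single u (3 * i) 3 3 (s≤s z≤n) ≤-refl trivial n)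
      (trans (cong (λ k → u k n) 3i+3≡3[1+i])
      (trans (cong₂ (λ x y → factor (3 * suc i) x y n) (stretch₃-3i a (suc i)) (stretch₃-3i b (suc i)))
             (sym (factor-frobenius i (a (suc i)) (b (suc i)) n))))
      where
      3i+3≡3[1+i] : 3 * i + 3 ≡ 3 * suc i
      3i+3≡3[1+i] = trans (+-comm (3 * i) 3) (sym (*-suc 3 i))
      trivial : ∀ r → 1 ≤ r → r ≤ 3 → r ≢ 3 → u (3 * i + r) ≈ 𝟙
      trivial 1 _ _ _ n = trans (cong₂ (λ x y → factor (3 * i + 1) x y n) (stretch₃-3i+1 a i) (stretch₃-3i+1 b i))
                                (factor-0-0 (3 * i + 1) n)
      trivial 2 _ _ _ n = trans (cong₂ (λ x y → factor (3 * i + 2) x y n) (stretch₃-3i+2 a i) (stretch₃-3i+2 b i))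
                                (factor-0-0 (3 * i + 2) n)
      trivial 3 _ _ 3≢3 = contradiction refl 3≢3
      trivial (suc (suc (suc (suc _)))) _ (s≤s (s≤s (s≤s ()))) _

module PartitionSeries where

  open import Data.Bool using (true; false; if_then_else_; T)
  open import Data.List using (List; []; _∷_; _++_; map; upTo; applyUpTo; replicate; concatMap)
  open import Data.List.Properties using (upTo-∷ʳ; map-++; map-upTo)
  open import Data.Nat as ℕ
    using (ℕ; zero; suc; _+_; _*_; _∸_; _≤_; _<_; _≤ᵇ_; _<ᵇ_; _≤?_; z≤n; s≤s; >-nonZero)
  open import Data.Nat.DivMod using (_mod_)
  open import Data.Nat.ListAction using (sum)
  open import Data.Nat.Properties
    using (≤-trans; ≰⇒>; m≤m+n; m≤m*n; m+[n∸m]≡n; [m+n]∸[m+o]≡n∸o; <-irrefl; ≤ᵇ⇒≤; ≤⇒≤ᵇ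
          ; ∸-monoʳ-<)
  open import Function using (_∘_)
  open import Relation.Binary.PropositionalEquality
    using (_≡_; refl; sym; trans; cong; cong₂; module ≡-Reasoning)
  open import Relation.Nullary using (¬_; yes; no; contradiction)

  open 𝔽₃ using (mod3-+)
  open PowerSeries
  open EtaProducts

  if-true : ∀ {b} (x : ℕ) → T b → (if b then x else 0) ≡ x
  if-true {true} x _ = refl

  if-false : ∀ {b} (x : ℕ) → ¬ T b → (if b then x else 0) ≡ 0
  if-false {true}  x ¬T = contradiction _ ¬T
  if-false {false} x _  = refl

  ≤ᵇ-+ : ∀ t a b → (t + a ≤ᵇ t + b) ≡ (a ≤ᵇ b)
  ≤ᵇ-+ zero    a b = refl
  ≤ᵇ-+ (suc t) a b = trans (<ᵇ-suc (t + a) (t + b)) (≤ᵇ-+ t a b)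
    where
    <ᵇ-suc : ∀ x y → (x <ᵇ suc y) ≡ (x ≤ᵇ y)
    <ᵇ-suc zero    y = refl
    <ᵇ-suc (suc x) y = refl

  sum-applyUpTo-cong : ∀ {g h} L → (∀ k → g k ≡ h k) → sum (applyUpTo g L) ≡ sum (applyUpTo h L)
  sum-applyUpTo-cong zero    g≡h = refl
  sum-applyUpTo-cong (suc L) g≡h = cong₂ _+_ (g≡h 0) (sum-applyUpTo-cong L (g≡h ∘ suc))

  sum-applyUpTo-extend : ∀ {g} L K → (∀ k → L ≤ k → g k ≡ 0) → sum (applyUpTo g (L + K)) ≡ sum (applyUpTo g L)
  sum-applyUpTo-extend         zero    zero    g≡0 = refl
  sum-applyUpTo-extend {g}     zero    (suc K) g≡0 =
    cong₂ _+_ (g≡0 0 z≤n) (sum-applyUpTo-extend {g ∘ suc} zero K λ k _ → g≡0 (suc k) z≤n)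
  sum-applyUpTo-extend {g}     (suc L) K       g≡0 =
    cong (g 0 +_) (sum-applyUpTo-extend {g ∘ suc} L K λ k L≤k → g≡0 (suc k) (s≤s L≤k))

  module _ (t : ℕ) (ts : List ℕ) where

    summand : ℕ → ℕ → ℕ
    summand n k = if k * t ≤ᵇ n then countReps ts (n ∸ k * t) else 0

    countReps-sum : ∀ n → countReps (t ∷ ts) n ≡ sum (applyUpTo (summand n) (suc n))
    countReps-sum n = cong sum (map-upTo (summand n) (suc n))

    summand-suc : ∀ {n} → t ≤ n → ∀ k → summand n (suc k) ≡ summand (n ∸ t) k
    summand-suc {n} t≤n k = begin
      summand n (suc k)
        ≡⟨ cong (λ m → summand m (suc k)) (sym n≡t+n′) ⟩
      (if t + k * t ≤ᵇ t + n′ then countReps ts (t + n′ ∸ (t + k * t)) else 0)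
        ≡⟨ cong₂ (λ b m → if b then countReps ts m else 0)
                   (≤ᵇ-+ t (k * t) n′) ([m+n]∸[m+o]≡n∸o t n′ (k * t)) ⟩
      summand n′ k                                                               ∎
      where
      open ≡-Reasoning
      n′ : ℕ
      n′ = n ∸ t
      n≡t+n′ : t + n′ ≡ n
      n≡t+n′ = m+[n∸m]≡n t≤n

    summand-beyond : 1 ≤ t → ∀ {n k} → n < k → summand n k ≡ 0
    summand-beyond 1≤t {n} {k} n<k =
      if-false _ λ kt≤n → <-irrefl refl (≤-trans n<k (≤-trans (m≤m*n k t) (≤ᵇ⇒≤ (k * t) n kt≤n)))
      where instance _ = >-nonZero 1≤t

    countReps-step : 1 ≤ t → ∀ n →
      countReps (t ∷ ts) n ≡ countReps ts n + (if t ≤ᵇ n then countReps (t ∷ ts) (n ∸ t) else 0)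
    countReps-step 1≤t n with t ≤? n
    ... | yes t≤n =
      trans (countReps-sum n) (cong (countReps ts n +_) (trans later-summands (sym (if-true _ (≤⇒≤ᵇ t≤n)))))
      where
      n′ : ℕ
      n′ = n ∸ t
      n≡[1+n′]+rest : suc n′ + (n ∸ suc n′) ≡ n
      n≡[1+n′]+rest = m+[n∸m]≡n (∸-monoʳ-< 1≤t t≤n)
      later-summands : sum (applyUpTo (summand n ∘ suc) n) ≡ countReps (t ∷ ts) n′
      later-summands = begin
        sum (applyUpTo (summand n ∘ suc) n)
          ≡⟨ sum-applyUpTo-cong n (summand-suc t≤n) ⟩
        sum (applyUpTo (summand n′) n)
          ≡⟨ cong (sum ∘ applyUpTo (summand n′)) n≡[1+n′]+rest ⟨
        sum (applyUpTo (summand n′) (suc n′ + (n ∸ suc n′)))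
          ≡⟨ sum-applyUpTo-extend (suc n′) _ (λ k → summand-beyond 1≤t) ⟩
        sum (applyUpTo (summand n′) (suc n′))
          ≡⟨ countReps-sum n′ ⟨
        countReps (t ∷ ts) n′                                    ∎
        where open ≡-Reasoning
    ... | no  t≰n = trans (countReps-sum n) (cong (countReps ts n +_)
      (trans (sum-vanishes n λ k → if-false _ λ le → t≰n (≤-trans (m≤m+n t (k * t)) (≤ᵇ⇒≤ _ n le)))
             (sym (if-false _ λ le → t≰n (≤ᵇ⇒≤ t n le)))))
      where
      sum-vanishes : ∀ {g} L → (∀ k → g k ≡ 0) → sum (applyUpTo g L) ≡ 0
      sum-vanishes L g≡0 = sum-applyUpTo-extend zero L λ k _ → g≡0 k

  reps : List ℕ → Series
  reps ts n = countReps ts n mod 3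

  reps-[] : reps [] ≈ 𝟙
  reps-[] zero    = refl
  reps-[] (suc n) = refl

  reps-∷ : ∀ t ts → 1 ≤ t → reps (t ∷ ts) ≈ reps ts ⊕ q^ t ⊛ reps (t ∷ ts)
  reps-∷ t ts 1≤t n = begin
    countReps (t ∷ ts) n mod 3                                 ≡⟨ cong (_mod 3) (countReps-step t ts 1≤t n) ⟩
    (countReps ts n + later n) mod 3                           ≡⟨ mod3-+ (countReps ts n) (later n) ⟩
    reps ts n +F later n mod 3                                 ≡⟨ cong (reps ts n +F_) (shifted n) ⟩
    reps ts n +F (q^ t ⊛ reps (t ∷ ts)) n                      ∎
    where
    open ≡-Reasoning
    later : ℕ → ℕ
    later n = if t ≤ᵇ n then countReps (t ∷ ts) (n ∸ t) else 0
    shifted : ∀ n → later n mod 3 ≡ (q^ t ⊛ reps (t ∷ ts)) n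
    shifted n with t ≤? n
    ... | yes t≤n = trans (cong (_mod 3) (if-true _ (≤⇒≤ᵇ t≤n))) (sym (q^⊛-≥ t (reps (t ∷ ts)) t≤n))
    ... | no  t≰n = trans (cong (_mod 3) (if-false _ λ le → t≰n (≤ᵇ⇒≤ t n le)))
                          (sym (q^⊛-< t (reps (t ∷ ts)) (≰⇒> t≰n)))

  reps-∷-geom : ∀ m ts → reps (suc m ∷ ts) ≈ geom (suc m) ⊛ reps ts
  reps-∷-geom m ts = begin
    R                              ≈⟨ ⊛-identityˡ R ⟨
    𝟙 ⊛ R                          ≈⟨ ⊛-congʳ R (1-q^-⊛-geom m) ⟨
    (1-q^ M ⊛ geom M) ⊛ R          ≈⟨ ⊛-congʳ R (⊛-comm (1-q^ M) (geom M)) ⟩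
    (geom M ⊛ 1-q^ M) ⊛ R          ≈⟨ ⊛-assoc (geom M) (1-q^ M) R ⟩
    geom M ⊛ (1-q^ M ⊛ R)          ≈⟨ ⊛-congˡ (geom M) peel ⟩
    geom M ⊛ reps ts               ∎
    where
    open ≈-Reasoning
    M : ℕ
    M = suc m
    R : Series
    R = reps (M ∷ ts)
    peel : 1-q^ M ⊛ R ≈ reps ts
    peel n = trans (solve 3 (λ x r s → (con 1F :- x) :* r := s :+ (r :- (s :+ x :* r))) (λ _ → refl) (q^ M) R (reps ts) n)
                   (trans (cong (λ y → reps ts n +F (R n +F -F y)) (sym (reps-∷ M ts (s≤s z≤n) n)))
                          (trans (cong (reps ts n +F_) (-F-inverseʳ (R n))) (+F-identityʳ (reps ts n))))

  reps-replicate : ∀ m k ts → reps (replicate k (suc m) ++ ts) ≈ geom (suc m) ^ k ⊛ reps ts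
  reps-replicate m zero    ts n = sym (⊛-identityˡ (reps ts) n)
  reps-replicate m (suc k) ts n = trans (reps-∷-geom m (replicate k (suc m) ++ ts) n)
    (trans (⊛-congˡ (geom (suc m)) (reps-replicate m k ts) n) (sym (⊛-assoc (geom (suc m)) (geom (suc m) ^ k) (reps ts) n)))

  geomProduct : (ℕ → ℕ) → List ℕ → Series
  geomProduct c []       = 𝟙
  geomProduct c (m ∷ ms) = geom m ^ c m ⊛ geomProduct c ms

  geomProduct-++ : ∀ c xs ys → geomProduct c (xs ++ ys) ≈ geomProduct c xs ⊛ geomProduct c ys
  geomProduct-++ c []       ys n = sym (⊛-identityˡ (geomProduct c ys) n)
  geomProduct-++ c (x ∷ xs) ys n = trans (⊛-congˡ (geom x ^ c x) (geomProduct-++ c xs ys) n)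
    (sym (⊛-assoc (geom x ^ c x) (geomProduct c xs) (geomProduct c ys) n))

  reps-coloured : ∀ c ms → reps (concatMap (λ m → replicate (c m) m) (map suc ms)) ≈ geomProduct c (map suc ms)
  reps-coloured c []       = reps-[]
  reps-coloured c (m ∷ ms) n =
    trans (reps-replicate m (c (suc m)) _ n) (⊛-congˡ (geom (suc m) ^ c (suc m)) (reps-coloured c ms) n)

  geomProduct-upTo : ∀ c N → geomProduct c (map suc (upTo N)) ≈ ∏≤ (factors (λ _ → 0) c) N
  geomProduct-upTo c zero    = λ _ → refl
  geomProduct-upTo c (suc N) n = begin
    geomProduct c (map suc (upTo (suc N))) n
      ≡⟨ cong (λ l → geomProduct c (map suc l) n) (upTo-∷ʳ N) ⟨
    geomProduct c (map suc (upTo N ++ N ∷ [])) n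
      ≡⟨ cong (λ l → geomProduct c l n) (map-++ suc (upTo N) (N ∷ [])) ⟩
    geomProduct c (map suc (upTo N) ++ suc N ∷ []) n
      ≡⟨ geomProduct-++ c (map suc (upTo N)) (suc N ∷ []) n ⟩
    (geomProduct c (map suc (upTo N)) ⊛ (geom (suc N) ^ c (suc N) ⊛ 𝟙)) n
      ≡⟨ ⊛-cong (geomProduct-upTo c N) last-factor n ⟩
    ∏≤ (factors (λ _ → 0) c) (suc N) n ∎
    where
    open ≡-Reasoning
    last-factor : geom (suc N) ^ c (suc N) ⊛ 𝟙 ≈ 𝟙 ⊛ geom (suc N) ^ c (suc N)
    last-factor i = trans (⊛-identityʳ _ i) (sym (⊛-identityˡ _ i))

  a-mod3 : ∀ r s n → a r s n mod 3 ≡ Π (λ _ → 0) (colours r s) n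
  a-mod3 r s n = trans (reps-coloured (colours r s) (upTo n) n) (geomProduct-upTo (colours r s) n n)

module ThetaSeries where

  open import Data.Nat as ℕ using (ℕ; zero; suc; pred; _+_; _*_; _≤_; _<_; _%_; z≤n; s≤s; NonZero; >-nonZero)
  open import Data.Nat.Properties
    using (+-comm; *-comm; *-identityˡ; *-cancelʳ-≡; *-suc; ≤-trans; <-≤-trans; ≤-reflexive; m≤m+n; m≤m*n)
  open import Data.Nat.DivMod using (m%n<n; %-distribˡ-*; m%n*o≡m*o%[n*o])
  open import Data.Nat.Divisibility using (_∣_; m∣m*n; n∣m⇒m%n≡0)
  open import Data.Nat.Tactic.RingSolver using (solve-∀)
  open import Function using (_∘_)
  open import Relation.Binary.PropositionalEquality
    using (_≡_; _≢_; refl; sym; trans; cong; cong₂; subst; module ≡-Reasoning)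

  open PowerSeries
  open SeriesSums

  tri : ℕ → ℕ
  tri zero    = 0
  tri (suc k) = suc k + tri k

  tri-pred : ∀ k → tri k ≡ tri (pred k) + k
  tri-pred zero    = refl
  tri-pred (suc k) = +-comm (suc k) (tri k)

  tri-square : ∀ k → k * k ≡ tri (pred k) + tri (pred k) + k
  tri-square zero    = refl
  tri-square (suc k) = begin
    suc k * suc k                  ≡⟨ square-suc k ⟩
    k * k + (k + k + 1)            ≡⟨ cong (_+ (k + k + 1)) (tri-square k) ⟩
    x + x + k + (k + k + 1)        ≡⟨ regroup x k ⟩
    (x + k) + (x + k) + suc k      ≡⟨ cong (λ m → m + m + suc k) (tri-pred k) ⟨
    tri k + tri k + suc k          ∎
    where
    open ≡-Reasoning
    x : ℕ
    x = tri (pred k)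
    square-suc : ∀ k → suc k * suc k ≡ k * k + (k + k + 1)
    square-suc = solve-∀
    regroup : ∀ x k → x + x + k + (k + k + 1) ≡ (x + k) + (x + k) + suc k
    regroup = solve-∀

  -- Θ α β is Σ_{k ∈ ℤ} (-1)^k q^(α k(k+1)/2 + β k(k-1)/2); the k-th term below pairs k ≥ 0 with -(k+1).
  e⁺ e⁻ : ℕ → ℕ → ℕ → ℕ
  e⁺ α β k = α * tri k + β * tri (pred k)
  e⁻ α β k = α * tri k + β * tri (suc k)

  sgn : ℕ → F3
  sgn zero    = 1F
  sgn (suc k) = -F sgn k

  θ-term : ℕ → ℕ → ℕ → Series
  θ-term α β k = const (sgn k) ⊛ (q^ e⁺ α β k ⊝ q^ e⁻ α β k)

  Θ : ℕ → ℕ → Series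
  Θ α β = ∑ (θ-term α β)

  module _ (k : ℕ) where
    private
      x : ℕ
      x = tri (pred k)
      open ≡-Reasoning

    e⁺-diagonal : ∀ a → e⁺ a a k ≡ a * (k * k)
    e⁺-diagonal a = begin
      a * tri k + a * x              ≡⟨ cong (λ m → a * m + a * x) (tri-pred k) ⟩
      a * (x + k) + a * x            ≡⟨ regroup a x k ⟩
      a * (x + x + k)                ≡⟨ cong (a *_) (tri-square k) ⟨
      a * (k * k)                    ∎
      where
      regroup : ∀ a x k → a * (x + k) + a * x ≡ a * (x + x + k)
      regroup = solve-∀

    e⁻-diagonal : ∀ a → e⁻ a a k ≡ a * (suc k * suc k)
    e⁻-diagonal a = begin
      a * tri k + a * (suc k + tri k)          ≡⟨ cong (λ m → a * m + a * (suc k + m)) (tri-pred k) ⟩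
      a * (x + k) + a * (suc k + (x + k))      ≡⟨ regroup a x k ⟩
      a * ((x + x + k) + (k + k + 1))          ≡⟨ cong (λ m → a * (m + (k + k + 1))) (tri-square k) ⟨
      a * (k * k + (k + k + 1))                ≡⟨ cong (a *_) (square-suc k) ⟩
      a * (suc k * suc k)                      ∎
      where
      regroup : ∀ a x k → a * (x + k) + a * (suc k + (x + k)) ≡ a * ((x + x + k) + (k + k + 1))
      regroup = solve-∀
      square-suc : ∀ k → k * k + (k + k + 1) ≡ suc k * suc k
      square-suc = solve-∀

    e⁺-15-3 : e⁺ 15 3 k ≡ 9 * (k * k) + 6 * k
    e⁺-15-3 = begin
      15 * tri k + 3 * x             ≡⟨ cong (λ m → 15 * m + 3 * x) (tri-pred k) ⟩
      15 * (x + k) + 3 * x           ≡⟨ regroup x k ⟩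
      9 * (x + x + k) + 6 * k        ≡⟨ cong (λ m → 9 * m + 6 * k) (tri-square k) ⟨
      9 * (k * k) + 6 * k            ∎
      where
      regroup : ∀ x k → 15 * (x + k) + 3 * x ≡ 9 * (x + x + k) + 6 * k
      regroup = solve-∀

    e⁻-15-3 : e⁻ 15 3 k ≡ 9 * (k * k) + 12 * k + 3
    e⁻-15-3 = begin
      15 * tri k + 3 * (suc k + tri k)          ≡⟨ cong (λ m → 15 * m + 3 * (suc k + m)) (tri-pred k) ⟩
      15 * (x + k) + 3 * (suc k + (x + k))      ≡⟨ regroup x k ⟩
      9 * (x + x + k) + 12 * k + 3              ≡⟨ cong (λ m → 9 * m + 12 * k + 3) (tri-square k) ⟨
      9 * (k * k) + 12 * k + 3                  ∎
      where
      regroup : ∀ x k → 15 * (x + k) + 3 * (suc k + (x + k)) ≡ 9 * (x + x + k) + 12 * k + 3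
      regroup = solve-∀

  tri-≥ : ∀ k → k ≤ tri k
  tri-≥ zero    = z≤n
  tri-≥ (suc k) = m≤m+n (suc k) (tri k)

  module _ (α β : ℕ) (1≤α : 1 ≤ α) where
    private
      ≤-α*tri : ∀ k y → k ≤ α * tri k + y
      ≤-α*tri k y = ≤-trans (tri-≥ k) (≤-trans (m≤m*n (tri k) α {{>-nonZero 1≤α}})
                                               (≤-trans (≤-reflexive (*-comm (tri k) α)) (m≤m+n _ y)))

    e⁺-≥ : ∀ k → k ≤ e⁺ α β k
    e⁺-≥ k = ≤-α*tri k (β * tri (pred k))

    e⁻-≥ : ∀ k → k ≤ e⁻ α β k
    e⁻-≥ k = ≤-α*tri k (β * tri (suc k))

    θ-term-summable : Summable (θ-term α β)
    θ-term-summable k n n<k = trans (const-⊛ (sgn k) _ n)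
      (trans (cong (sgn k *F_) (cong₂ (λ x y → x +F -F y) (q^-< (<-≤-trans n<k (e⁺-≥ k)))
                                                          (q^-< (<-≤-trans n<k (e⁻-≥ k)))))
             (*F-zeroʳ (sgn k)))

  Θ-vanishes : ∀ α β n → (∀ k → n ≢ e⁺ α β k) → (∀ k → n ≢ e⁻ α β k) → Θ α β n ≡ 0F
  Θ-vanishes α β n n≢e⁺ n≢e⁻ = ∑<-extend-at (θ-term α β) zero (suc n) n λ k _ →
    trans (const-⊛ (sgn k) _ n)
          (trans (cong (sgn k *F_) (cong₂ (λ x y → x +F -F y) (q^-≢ (n≢e⁺ k)) (q^-≢ (n≢e⁻ k))))
                 (*F-zeroʳ (sgn k)))

  θ-term-≈ : ∀ α β k {a b} → e⁺ α β k ≡ a → e⁻ α β k ≡ b →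
             θ-term α β k ≈ const (sgn k) ⊛ (q^ a ⊝ q^ b)
  θ-term-≈ α β k refl refl = λ _ → refl

  sgn-2+ : ∀ k → sgn (2 + k) ≡ sgn k
  sgn-2+ k = -F-involutive (sgn k)

  sgn-3* : ∀ t → sgn (3 * t) ≡ sgn t
  sgn-3* zero    = refl
  sgn-3* (suc t) = trans (cong sgn (*-suc 3 t)) (trans (cong -F_ (sgn-2+ (3 * t))) (cong -F_ (sgn-3* t)))


  θ-term-1-1 : ∀ k → θ-term 1 1 k ≈ const (sgn k) ⊛ (q^ (k * k) ⊝ q^ (suc k * suc k))
  θ-term-1-1 k = θ-term-≈ 1 1 k (trans (e⁺-diagonal k 1) (*-identityˡ (k * k)))
                               (trans (e⁻-diagonal k 1) (*-identityˡ (suc k * suc k)))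

  module Dissection (t : ℕ) where

    s : Series
    s = const (sgn t)

    A B C D : Series
    A = q^ (3 * t * (3 * t))
    B = q^ (suc (3 * t) * suc (3 * t))
    C = q^ ((2 + 3 * t) * (2 + 3 * t))
    D = q^ ((3 + 3 * t) * (3 + 3 * t))

    term₀ : θ-term 1 1 (3 * t) ≈ s ⊛ (A ⊝ B)
    term₀ n = trans (θ-term-1-1 (3 * t) n) (⊛-congʳ (A ⊝ B) (λ i → cong (λ c → const c i) (sgn-3* t)) n)

    term₁ : θ-term 1 1 (1 + 3 * t) ≈ ⊖ s ⊛ (B ⊝ C)
    term₁ n = trans (θ-term-1-1 (1 + 3 * t) n)
                    (⊛-congʳ (B ⊝ C) (λ i → trans (cong (λ c → const (-F c) i) (sgn-3* t)) (const-⊖ (sgn t) i)) n)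

    term₂ : θ-term 1 1 (2 + 3 * t) ≈ s ⊛ (C ⊝ D)
    term₂ n = trans (θ-term-1-1 (2 + 3 * t) n)
                    (⊛-congʳ (C ⊝ D) (λ i → cong (λ c → const c i) (trans (sgn-2+ (3 * t)) (sgn-3* t))) n)

    term-9-9 : θ-term 9 9 t ≈ s ⊛ (A ⊝ D)
    term-9-9 = θ-term-≈ 9 9 t (trans (e⁺-diagonal t 9) (square₀ t)) (trans (e⁻-diagonal t 9) (square₃ t))
      where
      square₀ : ∀ t → 9 * (t * t) ≡ 3 * t * (3 * t)
      square₀ = solve-∀
      square₃ : ∀ t → 9 * (suc t * suc t) ≡ (3 + 3 * t) * (3 + 3 * t)
      square₃ = solve-∀

    q⊛term-15-3 : q^ 1 ⊛ θ-term 15 3 t ≈ s ⊛ (B ⊝ C)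
    q⊛term-15-3 n = begin
      (q^ 1 ⊛ θ-term 15 3 t) n
        ≡⟨ ⊛-congˡ (q^ 1) (θ-term-≈ 15 3 t (e⁺-15-3 t) (e⁻-15-3 t)) n ⟩
      (q^ 1 ⊛ (s ⊛ (q^ (9 * (t * t) + 6 * t) ⊝ q^ (9 * (t * t) + 12 * t + 3)))) n
        ≡⟨ solve 4 (λ x s a b → x :* (s :* (a :- b)) := s :* (x :* a :- x :* b)) (λ _ → refl)
                   (q^ 1) s (q^ (9 * (t * t) + 6 * t)) (q^ (9 * (t * t) + 12 * t + 3)) n ⟩
      (s ⊛ (q^ 1 ⊛ q^ (9 * (t * t) + 6 * t) ⊝ q^ 1 ⊛ q^ (9 * (t * t) + 12 * t + 3))) n
        ≡⟨ ⊛-congˡ s (λ i → cong₂ (λ x y → x +F -F y) (shift (square₁ t) i) (shift (square₂ t) i)) n ⟩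
      (s ⊛ (B ⊝ C)) n ∎
      where
      open ≡-Reasoning
      shift : ∀ {e e′} → 1 + e ≡ e′ → q^ 1 ⊛ q^ e ≈ q^ e′
      shift {e} refl i = sym (q^-+ 1 e i)
      square₁ : ∀ t → 1 + (9 * (t * t) + 6 * t) ≡ suc (3 * t) * suc (3 * t)
      square₁ = solve-∀
      square₂ : ∀ t → 1 + (9 * (t * t) + 12 * t + 3) ≡ (2 + 3 * t) * (2 + 3 * t)
      square₂ = solve-∀

    -- s (A - B) - s (B - C) + s (C - D) = s (A - D) + s (B - C) because -2 = 1 in F₃.
    block : θ-term 1 1 (3 * t) ⊕ θ-term 1 1 (1 + 3 * t) ⊕ θ-term 1 1 (2 + 3 * t) ≈
            θ-term 9 9 t ⊕ q^ 1 ⊛ θ-term 15 3 t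
    block n = trans (⊕-cong (⊕-cong term₀ term₁) term₂ n)
      (trans (solve 5 (λ s a b c d → s :* (a :- b) :+ (:- s) :* (b :- c) :+ s :* (c :- d)
                                   := s :* (a :- d) :+ s :* (b :- c))
                      (λ _ → refl) s A B C D n)
             (sym (⊕-cong term-9-9 q⊛term-15-3 n)))

  Θ-1-1-dissection : Θ 1 1 ≈ Θ 9 9 ⊕ q^ 1 ⊛ Θ 15 3
  Θ-1-1-dissection n = begin
    Θ 1 1 n
      ≡⟨ ∑-group3 (θ-term-summable 1 1 (s≤s z≤n)) n ⟩
    ∑ (λ t → θ-term 1 1 (3 * t) ⊕ θ-term 1 1 (1 + 3 * t) ⊕ θ-term 1 1 (2 + 3 * t)) n
      ≡⟨ ∑-cong Dissection.block n ⟩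
    ∑ (λ t → θ-term 9 9 t ⊕ q^ 1 ⊛ θ-term 15 3 t) n
      ≡⟨ ∑-⊕ (θ-term 9 9) (λ t → q^ 1 ⊛ θ-term 15 3 t) n ⟩
    Θ 9 9 n +F ∑ (λ t → q^ 1 ⊛ θ-term 15 3 t) n
      ≡⟨ cong (Θ 9 9 n +F_) (∑-q (θ-term-summable 15 3 (s≤s z≤n)) n) ⟩
    Θ 9 9 n +F (q^ 1 ⊛ Θ 15 3) n                                                    ∎
    where open ≡-Reasoning

  module _ (d : ℕ) .{{_ : NonZero d}} where

    Θ-vanishesOn : ∀ α β r → (∀ k → e⁺ α β k % d ≢ r) → (∀ k → e⁻ α β k % d ≢ r) →
                   VanishesOn d r (Θ α β)
    Θ-vanishesOn α β r e⁺≢r e⁻≢r n n≡r =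
      Θ-vanishes α β n (λ k n≡e → e⁺≢r k (trans (cong (_% d) (sym n≡e)) n≡r))
                       (λ k n≡e → e⁻≢r k (trans (cong (_% d) (sym n≡e)) n≡r))

    Θ-supported : ∀ α β → (∀ k → d ∣ e⁺ α β k) → (∀ k → d ∣ e⁻ α β k) → Supported d (Θ α β)
    Θ-supported α β d∣e⁺ d∣e⁻ n n≢0 =
      Θ-vanishes α β n (λ k n≡e → n≢0 (n∣m⇒m%n≡0 n d (subst (d ∣_) (sym n≡e) (d∣e⁺ k))))
                       (λ k n≡e → n≢0 (n∣m⇒m%n≡0 n d (subst (d ∣_) (sym n≡e) (d∣e⁻ k))))

  Θ-9-9-supported : Supported 9 (Θ 9 9)
  Θ-9-9-supported = Θ-supported 9 9 9 (λ k → subst (9 ∣_) (sym (e⁺-diagonal k 9)) (m∣m*n (k * k)))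
                                      (λ k → subst (9 ∣_) (sym (e⁻-diagonal k 9)) (m∣m*n (suc k * suc k)))

  Θ-15-3-supported : Supported 3 (Θ 15 3)
  Θ-15-3-supported = Θ-supported 3 15 3
    (λ k → subst (3 ∣_) (sym (trans (e⁺-15-3 k) (factor₁ k))) (m∣m*n (3 * (k * k) + 2 * k)))
    (λ k → subst (3 ∣_) (sym (trans (e⁻-15-3 k) (factor₂ k))) (m∣m*n (3 * (k * k) + 4 * k + 1)))
    where
    factor₁ : ∀ k → 9 * (k * k) + 6 * k ≡ 3 * (3 * (k * k) + 2 * k)
    factor₁ = solve-∀
    factor₂ : ∀ k → 9 * (k * k) + 12 * k + 3 ≡ 3 * (3 * (k * k) + 4 * k + 1)
    factor₂ = solve-∀

  square≢2-mod-3 : ∀ k → (k * k) % 3 ≢ 2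
  square≢2-mod-3 k = by-residue (k % 3) (m%n<n k 3) (%-distribˡ-* k k 3)
    where
    by-residue : ∀ r → r < 3 → (k * k) % 3 ≡ (r * r) % 3 → (k * k) % 3 ≢ 2
    by-residue 0 _ k²≡ k²≡2 with () ← trans (sym k²≡) k²≡2
    by-residue 1 _ k²≡ k²≡2 with () ← trans (sym k²≡) k²≡2
    by-residue 2 _ k²≡ k²≡2 with () ← trans (sym k²≡) k²≡2
    by-residue (suc (suc (suc _))) (s≤s (s≤s (s≤s ()))) _

  3*square≢6-mod-9 : ∀ k → 3 * (k * k) % 9 ≢ 6
  3*square≢6-mod-9 k eq = square≢2-mod-3 k (*-cancelʳ-≡ ((k * k) % 3) 2 3
    (trans (m%n*o≡m*o%[n*o] (k * k) 3 3) (trans (cong (_% 9) (*-comm (k * k) 3)) eq)))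

  Θ-3-3-vanishesOn-6 : VanishesOn 9 6 (Θ 3 3)
  Θ-3-3-vanishesOn-6 = Θ-vanishesOn 9 3 3 6
    (λ k → 3*square≢6-mod-9 k ∘ trans (cong (_% 9) (sym (e⁺-diagonal k 3))))
    (λ k → 3*square≢6-mod-9 (suc k) ∘ trans (cong (_% 9) (sym (e⁻-diagonal k 3))))

module GaussianBinomial (Q : PowerSeries.Series) where

  open import Data.Nat as ℕ using (ℕ; zero; suc; _+_; _∸_; _≤_; _<_; z≤n; s≤s)
  open import Data.Nat.Properties
    using (+-suc; +-comm; +-identityʳ; +-monoʳ-≤; m+n∸m≡n; suc-injective; ≤-refl; ≤-trans; ≤-pred
          ; ≤-reflexive; m≤n⇒m≤1+n)
  open import Relation.Binary.PropositionalEquality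
    using (_≡_; refl; sym; trans; cong; cong₂; module ≡-Reasoning)

  open PowerSeries

  E : ℕ → Series
  E m = 𝟙 ⊝ Q ^ m

  [_]! : ℕ → Series
  [ zero  ]! = 𝟙
  [ suc m ]! = [ m ]! ⊛ E (suc m)

  prev : (ℕ → Series) → ℕ → Series
  prev f zero    = 𝟘
  prev f (suc j) = f j

  -- B n j is the Gaussian binomial coefficient [2n choose j] in Q.
  B : ℕ → ℕ → Series
  B zero    zero    = 𝟙
  B zero    (suc j) = 𝟘
  B (suc n) j = Q ^ j ⊛ B n j ⊕ (𝟙 ⊕ Q ^ suc (n + n)) ⊛ prev (B n) j
                ⊕ Q ^ (suc (suc (n + n)) ∸ j) ⊛ prev (prev (B n)) j

  E-0 : E 0 ≈ 𝟘
  E-0 n = -F-inverseʳ (𝟙 n)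

  B-vanishes : ∀ n j → n + n < j → B n j ≈ 𝟘
  B-vanishes zero    (suc j)       _              = λ _ → refl
  B-vanishes (suc n) (suc (suc j)) (s≤s (s≤s le)) i =
    trans (cong₂ _+F_ (cong₂ _+F_ (vanish (2 + j) (m≤n⇒m≤1+n (m≤n⇒m≤1+n 2n<j)))
                                  (vanish (suc j) (m≤n⇒m≤1+n 2n<j)))
                      (vanish j 2n<j))
          (trans (+F-identityʳ _) (+F-identityʳ 0F))
    where
    2n<j : n + n < j
    2n<j = ≤-trans (≤-reflexive (sym (+-suc n n))) le
    vanish : ∀ {f} j → n + n < j → (f ⊛ B n j) i ≡ 0F
    vanish {f} j 2n<j = trans (⊛-congˡ f (B-vanishes n j 2n<j) i) (⊛-zeroʳ f i)

  private
    ⊕-vanishing : ∀ f g h → h ≈ 𝟘 → f ⊕ g ⊛ h ≈ f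
    ⊕-vanishing f g h h≈0 n = trans (cong (f n +F_) (⊛-vanishesʳ g h≈0 n)) (+F-identityʳ (f n))

  -- In the edge cases the terms without a matching factorial are killed by E 0 = 0.
  three-term-identity : ∀ W j k → j + k ≡ 2 + W →
    Q ^ j ⊛ (E (k ∸ 1) ⊛ E k) ⊕ (𝟙 ⊕ Q ^ suc W) ⊛ (E j ⊛ E k) ⊕ Q ^ k ⊛ (E (j ∸ 1) ⊛ E j)
      ≈ E (suc W) ⊛ E (2 + W)
  three-term-identity W zero .(2 + W) refl n = trans
    (solve 5 (λ e₁ e₂ x y z → con 1F :* (e₁ :* e₂) :+ (con 1F :+ x) :* (z :* e₂) :+ y :* (z :* z)
                           := e₁ :* e₂ :+ ((con 1F :+ x) :* e₂ :+ y :* z) :* z)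
           (λ _ → refl) (E (suc W)) (E (2 + W)) (Q ^ suc W) (Q ^ (2 + W)) (E 0) n)
    (⊕-vanishing (E (suc W) ⊛ E (2 + W)) _ (E 0) E-0 n)
  three-term-identity W (suc j) zero eq n with trans (sym (+-identityʳ (suc j))) eq
  ... | refl = trans
    (solve 5 (λ e₁ e₂ x y z → y :* (z :* z) :+ (con 1F :+ x) :* (e₂ :* z) :+ con 1F :* (e₁ :* e₂)
                           := e₁ :* e₂ :+ (y :* z :+ (con 1F :+ x) :* e₂) :* z)
           (λ _ → refl) (E (suc W)) (E (2 + W)) (Q ^ suc W) (Q ^ (2 + W)) (E 0) n)
    (⊕-vanishing (E (suc W) ⊛ E (2 + W)) _ (E 0) E-0 n)
  three-term-identity W (suc j) (suc k) eq n with trans (sym (+-suc j k)) (cong ℕ.pred eq)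
  ... | refl = trans
    (⊕-congʳ third (⊕-congˡ first (⊛-congʳ (E (suc j) ⊛ E (suc k)) (⊕-congˡ 𝟙 Q^1+W))) n)
    (trans (solve 3 (λ p u v → p :* u :* ((con 1F :- v) :* (con 1F :- p :* v))
                               :+ (con 1F :+ p :* (u :* v)) :* ((con 1F :- p :* u) :* (con 1F :- p :* v))
                               :+ p :* v :* ((con 1F :- u) :* (con 1F :- p :* u))
                            := (con 1F :- p :* (u :* v)) :* (con 1F :- p :* (p :* (u :* v))))
                  (λ _ → refl) Q (Q ^ j) (Q ^ k) n)
           (sym (⊛-cong (⊕-congˡ 𝟙 (⊖-cong Q^1+W)) (⊕-congˡ 𝟙 (⊖-cong (⊛-congˡ Q Q^1+W))) n)))
    where
    first third : Series
    first = Q ^ suc j ⊛ (E k ⊛ E (suc k))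
    third = Q ^ suc k ⊛ (E j ⊛ E (suc j))
    Q^1+W : Q ^ suc (j + k) ≈ Q ⊛ (Q ^ j ⊛ Q ^ k)
    Q^1+W = ⊛-congˡ Q (^-homo-* Q j k)

  private
    E-0-left : ∀ k g → (E 0 ⊛ E k) ⊛ g ≈ 𝟘
    E-0-left k g = ⊛-vanishesˡ g (⊛-vanishesˡ (E k) E-0)

    E-0-right : ∀ j g → (E j ⊛ E 0) ⊛ g ≈ 𝟘
    E-0-right j g = ⊛-vanishesˡ g (⊛-vanishesʳ (E j) E-0)

    pull : ∀ b f g e₁ e₂ → b ⊛ (f ⊛ ((g ⊛ e₁) ⊛ e₂)) ≈ (e₁ ⊛ e₂) ⊛ (b ⊛ (f ⊛ g))
    pull = solve 5 (λ b f g e₁ e₂ → b :* (f :* ((g :* e₁) :* e₂)) := (e₁ :* e₂) :* (b :* (f :* g)))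
                   (λ _ → refl)

    pull′ : ∀ b f g e₁ e₂ → b ⊛ ((f ⊛ e₁) ⊛ (g ⊛ e₂)) ≈ (e₁ ⊛ e₂) ⊛ (b ⊛ (f ⊛ g))
    pull′ = solve 5 (λ b f g e₁ e₂ → b :* ((f :* e₁) :* (g :* e₂)) := (e₁ :* e₂) :* (b :* (f :* g)))
                    (λ _ → refl)

    pull″ : ∀ b f g e₁ e₂ → b ⊛ (((f ⊛ e₁) ⊛ e₂) ⊛ g) ≈ (e₁ ⊛ e₂) ⊛ (b ⊛ (f ⊛ g))
    pull″ = solve 5 (λ b f g e₁ e₂ → b :* (((f :* e₁) :* e₂) :* g) := (e₁ :* e₂) :* (b :* (f :* g)))
                    (λ _ → refl)

  Factorial : ℕ → Set
  Factorial n = ∀ j k → j + k ≡ n + n → B n j ⊛ ([ j ]! ⊛ [ k ]!) ≈ [ n + n ]!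

  module Step (n : ℕ) (IH : Factorial n) where

    W : ℕ
    W = n + n

    beyond : ∀ {j} → W < j → ∀ g → B n j ⊛ g ≈ 𝟘
    beyond W<j g = ⊛-vanishesˡ g (B-vanishes n _ W<j)

    beyond-index : ∀ j k → j + k ≡ 2 + W → k ≤ 1 → W < j
    beyond-index j k eq k≤1 =
      ≤-pred (≤-trans (≤-reflexive (sym eq)) (≤-trans (+-monoʳ-≤ j k≤1) (≤-reflexive (+-comm j 1))))

    term₀ : ∀ j k → j + k ≡ 2 + W → B n j ⊛ ([ j ]! ⊛ [ k ]!) ≈ (E (k ∸ 1) ⊛ E k) ⊛ [ W ]!
    term₀ j 0 eq = both-𝟘 (beyond (beyond-index j 0 eq z≤n) _) (E-0-left 0 [ W ]!)
    term₀ j 1 eq = both-𝟘 (beyond (beyond-index j 1 eq ≤-refl) _) (E-0-left 1 [ W ]!)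
    term₀ j (suc (suc k)) eq i = trans (pull (B n j) [ j ]! [ k ]! (E (suc k)) (E (2 + k)) i)
      (⊛-congˡ (E (suc k) ⊛ E (2 + k)) (IH j k j+k≡W) i)
      where
      j+k≡W : j + k ≡ W
      j+k≡W = suc-injective (suc-injective (trans (sym (trans (+-suc j (suc k)) (cong suc (+-suc j k)))) eq))

    term₁ : ∀ j k → j + k ≡ 2 + W → prev (B n) j ⊛ ([ j ]! ⊛ [ k ]!) ≈ (E j ⊛ E k) ⊛ [ W ]!
    term₁ zero    k       eq = both-𝟘 (⊛-vanishesˡ _ (λ _ → refl)) (E-0-left k [ W ]!)
    term₁ (suc j) zero    eq = both-𝟘 (beyond (beyond-index j 1 j+1≡2+W ≤-refl) _) (E-0-right (suc j) [ W ]!)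
      where
      j+1≡2+W : j + 1 ≡ 2 + W
      j+1≡2+W = trans (+-comm j 1) (trans (sym (+-identityʳ (suc j))) eq)
    term₁ (suc j) (suc k) eq i = trans (pull′ (B n j) [ j ]! [ k ]! (E (suc j)) (E (suc k)) i)
      (⊛-congˡ (E (suc j) ⊛ E (suc k)) (IH j k j+k≡W) i)
      where
      j+k≡W : j + k ≡ W
      j+k≡W = suc-injective (suc-injective (trans (sym (cong suc (+-suc j k))) eq))

    term₂ : ∀ j k → j + k ≡ 2 + W → prev (prev (B n)) j ⊛ ([ j ]! ⊛ [ k ]!) ≈ (E (j ∸ 1) ⊛ E j) ⊛ [ W ]!
    term₂ 0 k eq = both-𝟘 (⊛-vanishesˡ _ (λ _ → refl)) (E-0-left 0 [ W ]!)
    term₂ 1 k eq = both-𝟘 (⊛-vanishesˡ _ (λ _ → refl)) (E-0-left 1 [ W ]!)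
    term₂ (suc (suc j)) k eq i = trans (pull″ (B n j) [ j ]! [ k ]! (E (suc j)) (E (2 + j)) i)
      (⊛-congˡ (E (suc j) ⊛ E (2 + j)) (IH j k (suc-injective (suc-injective eq))) i)

    step : Factorial (suc n)
    step j k eq = begin
      B (suc n) j ⊛ F
        ≈⟨ distribute (Q ^ j) (B n j) X (prev (B n) j) (Q ^ (2 + W ∸ j)) (prev (prev (B n)) j) F ⟩
      Q ^ j ⊛ (B n j ⊛ F) ⊕ X ⊛ (prev (B n) j ⊛ F) ⊕ Q ^ (2 + W ∸ j) ⊛ (prev (prev (B n)) j ⊛ F)
        ≈⟨ ⊕-cong (⊕-cong (⊛-congˡ (Q ^ j) (term₀ j k eq′)) (⊛-congˡ X (term₁ j k eq′)))
                  (⊛-cong (λ i → cong (λ m → (Q ^ m) i) 2+W∸j≡k) (term₂ j k eq′)) ⟩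
      Q ^ j ⊛ (e₀ ⊛ [ W ]!) ⊕ X ⊛ (e₁ ⊛ [ W ]!) ⊕ Q ^ k ⊛ (e₂ ⊛ [ W ]!)
        ≈⟨ factor-out (Q ^ j) e₀ X e₁ (Q ^ k) e₂ [ W ]! ⟩
      (Q ^ j ⊛ e₀ ⊕ X ⊛ e₁ ⊕ Q ^ k ⊛ e₂) ⊛ [ W ]!
        ≈⟨ ⊛-congʳ [ W ]! (three-term-identity W j k eq′) ⟩
      (E (suc W) ⊛ E (2 + W)) ⊛ [ W ]!
        ≈⟨ solve 3 (λ a b w → (a :* b) :* w := (w :* a) :* b) (λ _ → refl) (E (suc W)) (E (2 + W)) [ W ]! ⟩
      [ 2 + W ]!
        ≡⟨ cong [_]! (cong suc (+-suc n n)) ⟨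
      [ suc n + suc n ]!
        ∎
      where
      open ≈-Reasoning
      F X e₀ e₁ e₂ : Series
      F = [ j ]! ⊛ [ k ]!
      X = 𝟙 ⊕ Q ^ suc W
      e₀ = E (k ∸ 1) ⊛ E k
      e₁ = E j ⊛ E k
      e₂ = E (j ∸ 1) ⊛ E j
      eq′ : j + k ≡ 2 + W
      eq′ = trans eq (cong suc (+-suc n n))
      2+W∸j≡k : 2 + W ∸ j ≡ k
      2+W∸j≡k = trans (cong (_∸ j) (sym eq′)) (m+n∸m≡n j k)
      distribute : ∀ a b c d e f g →
                   (a ⊛ b ⊕ c ⊛ d ⊕ e ⊛ f) ⊛ g ≈ a ⊛ (b ⊛ g) ⊕ c ⊛ (d ⊛ g) ⊕ e ⊛ (f ⊛ g)
      distribute = solve 7 (λ a b c d e f g → (a :* b :+ c :* d :+ e :* f) :* g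
                                            := a :* (b :* g) :+ c :* (d :* g) :+ e :* (f :* g))
                           (λ _ → refl)
      factor-out : ∀ a b c d e f g →
                   a ⊛ (b ⊛ g) ⊕ c ⊛ (d ⊛ g) ⊕ e ⊛ (f ⊛ g) ≈ (a ⊛ b ⊕ c ⊛ d ⊕ e ⊛ f) ⊛ g
      factor-out = solve 7 (λ a b c d e f g → a :* (b :* g) :+ c :* (d :* g) :+ e :* (f :* g)
                                            := (a :* b :+ c :* d :+ e :* f) :* g)
                           (λ _ → refl)

  B-factorial : ∀ n → Factorial n
  B-factorial zero    zero zero _ = λ i → trans (⊛-identityˡ (𝟙 ⊛ 𝟙) i) (⊛-identityˡ 𝟙 i)
  B-factorial (suc n) = Step.step n (B-factorial n)

module JacobiTripleProduct where

  open import Data.Bool using (if_then_else_)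
  open import Data.Nat as ℕ
    using (ℕ; zero; suc; pred; _+_; _*_; _∸_; _%_; _≡ᵇ_; _≤_; _<_; z≤n; s≤s; _≤?_; _≟_)
  open import Data.Nat.Properties
    using (*-suc; *-zeroʳ; *-comm; *-monoʳ-≤; +-comm; +-suc; +-assoc; +-identityʳ; +-cancelʳ-≡; +-monoʳ-≤
          ; ≤-refl; ≤-reflexive; ≤-trans; ≤-pred; ≤-<-trans; <-≤-trans; ≰⇒>; <⇒≢; <⇒≤; ≤∧≢⇒<
          ; m<m+n; m<n+m; m≤m+n; m≤n*m; n≤1+n; ∸-monoʳ-≤; m∸n≤m; m+n∸n≡m; m∸n+n≡m; m+[n∸m]≡n
          ; m+n≤o⇒m≤o∸n; [m+n]∸[m+o]≡n∸o)
  open import Data.Nat.DivMod using ([m+kn]%n≡m%n; m<n⇒m%n≡m; n%n≡0)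
  open import Function using (_∘_)
  open import Data.Nat.Tactic.RingSolver using (solve-∀)
  open import Relation.Nullary using (yes; no; contradiction)
  open import Relation.Binary.PropositionalEquality
    using (_≡_; _≢_; refl; sym; trans; cong; cong₂; module ≡-Reasoning)

  open PowerSeries
  open SeriesSums
  open ThetaSeries
  open EtaProducts

  module Exponents (α β : ℕ) where

    c : ℕ
    c = α + β

    -- expo j n = α m(m+1)/2 + β m(m-1)/2 for the integer m = j - n.
    expo : ℕ → ℕ → ℕ
    expo j       zero    = e⁺ α β j
    expo zero    (suc n) = e⁻ α β n
    expo (suc j) (suc n) = expo j n

    expo-up : ∀ n k → expo (n + k) n ≡ e⁺ α β k
    expo-up zero    k = refl
    expo-up (suc n) k = expo-up n k

    expo-down : ∀ j k → expo j (j + suc k) ≡ e⁻ α β k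
    expo-down zero    k = refl
    expo-down (suc j) k = expo-down j k

    expo-suc : ∀ j n → expo (suc j) n + c * n ≡ expo j n + c * j + α
    expo-suc j zero = begin
      α * (suc j + tri j) + β * tri j + c * 0
        ≡⟨ cong (λ x → α * (suc j + x) + β * x + c * 0) (tri-pred j) ⟩
      α * (suc j + (y + j)) + β * (y + j) + c * 0
        ≡⟨ regroup α β j y ⟩
      α * (y + j) + β * y + c * j + α
        ≡⟨ cong (λ x → α * x + β * y + c * j + α) (tri-pred j) ⟨
      α * tri j + β * y + c * j + α ∎
      where
      open ≡-Reasoning
      y : ℕ
      y = tri (pred j)
      regroup : ∀ α β j y → α * (suc j + (y + j)) + β * (y + j) + (α + β) * 0
                          ≡ α * (y + j) + β * y + (α + β) * j + α
      regroup = solve-∀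
    expo-suc zero (suc zero) = base α β
      where
      base : ∀ α β → (α * 0 + β * 0) + (α + β) * 1 ≡ (α * 0 + β * (1 + 0)) + (α + β) * 0 + α
      base = solve-∀
    expo-suc zero (suc (suc m)) = shift α β m (tri m)
      where
      shift : ∀ α β m x → (α * x + β * (suc m + x)) + (α + β) * suc (suc m)
                        ≡ (α * (suc m + x) + β * (suc (suc m) + (suc m + x))) + (α + β) * 0 + α
      shift = solve-∀
    expo-suc (suc j) (suc n) = begin
      expo (suc j) n + c * suc n          ≡⟨ cong (expo (suc j) n +_) (*-suc c n) ⟩
      expo (suc j) n + (c + c * n)        ≡⟨ swap (expo (suc j) n) c (c * n) ⟩
      c + (expo (suc j) n + c * n)        ≡⟨ cong (c +_) (expo-suc j n) ⟩
      c + (expo j n + c * j + α)          ≡⟨ swap′ c (expo j n) (c * j) α ⟩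
      expo j n + (c + c * j) + α          ≡⟨ cong (λ x → expo j n + x + α) (*-suc c j) ⟨
      expo j n + c * suc j + α            ∎
      where
      open ≡-Reasoning
      swap : ∀ x c y → x + (c + y) ≡ c + (x + y)
      swap = solve-∀
      swap′ : ∀ c x y α → c + (x + y + α) ≡ x + (c + y) + α
      swap′ = solve-∀

    expo-suc-n : ∀ j n → expo j n + β + c * n ≡ expo j (suc n) + c * j
    expo-suc-n j n = +-cancelʳ-≡ α _ _ (trans (regroup (expo j n) β α n) (expo-suc j (suc n)))
      where
      regroup : ∀ x β α n → x + β + (α + β) * n + α ≡ x + (α + β) * suc n
      regroup = solve-∀

    expo-mirror : ∀ j n → j ≤ n + n → expo (suc j) n + c * (n + n ∸ j) ≡ expo j n + α + c * n
    expo-mirror j n j≤2n = +-cancelʳ-≡ (c * j + c * n) _ _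
      (trans (regroup (expo (suc j) n) c n (n + n ∸ j) j)
      (trans (cong₂ (λ x y → x + c * y) (expo-suc j n) (m∸n+n≡m j≤2n))
             (regroup′ (expo j n) c j α n)))
      where
      regroup : ∀ x c n d j → (x + c * d) + (c * j + c * n) ≡ (x + c * n) + c * (d + j)
      regroup = solve-∀
      regroup′ : ∀ x c j α n → (x + c * j + α) + c * (n + n) ≡ (x + α + c * n) + (c * j + c * n)
      regroup′ = solve-∀

  module FiniteTripleProduct (α β : ℕ) where

    open Exponents α β public
    open GaussianBinomial (q^ c) public

    r : ℕ → ℕ → Series
    r n j = const (sgn (j + n)) ⊛ (q^ expo j n ⊛ B n j)

    r-vanishes : ∀ n j → n + n < j → r n j ≈ 𝟘
    r-vanishes n j 2n<j = ⊛-vanishesʳ (const (sgn (j + n))) (⊛-vanishesʳ (q^ expo j n) (B-vanishes n j 2n<j))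

    private
      sgn-+suc : ∀ j n → sgn (j + suc n) ≡ -F sgn (j + n)
      sgn-+suc j n = cong sgn (+-suc j n)

      q^-split : ∀ {x} y z → x ≡ y + z → q^ x ≈ q^ y ⊛ q^ z
      q^-split y z refl = q^-+ y z

      vanish₃ : ∀ s m y {b} → b ≈ 𝟘 → s ⊛ (m ⊛ (y ⊛ b)) ≈ 𝟘
      vanish₃ s m y b≈0 = ⊛-vanishesʳ s (⊛-vanishesʳ m (⊛-vanishesʳ y b≈0))

      flip-term : ∀ {σ τ e k} x y b → σ ≡ -F τ → e + c * k ≡ x + y →
                  const σ ⊛ (q^ e ⊛ (q^ c ^ k ⊛ b)) ≈ ⊖ q^ y ⊛ (const τ ⊛ (q^ x ⊛ b))
      flip-term {σ} {τ} {e} {k} x y b σ≡-τ e+ck≡x+y i = trans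
        (⊛-cong (λ i′ → trans (cong (λ z → const z i′) σ≡-τ) (const-⊖ τ i′)) exponent i)
        (solve 4 (λ s m p b → (:- s) :* ((m :* p) :* b) := (:- p) :* (s :* (m :* b))) (λ _ → refl)
               (const τ) (q^ x) (q^ y) b i)
        where
        exponent : q^ e ⊛ (q^ c ^ k ⊛ b) ≈ (q^ x ⊛ q^ y) ⊛ b
        exponent i = trans (sym (⊛-assoc (q^ e) (q^ c ^ k) b i))
          (⊛-congʳ b (λ i′ → trans (⊛-congˡ (q^ e) (q^-^ c k) i′)
                                   (trans (sym (q^-+ e (c * k) i′)) (q^-split x y e+ck≡x+y i′))) i)

    module _ (n : ℕ) where

      X : Series
      X = 𝟙 ⊕ q^ c ^ suc (n + n)

      r-term₀ : ∀ j → const (sgn (j + suc n)) ⊛ (q^ expo j (suc n) ⊛ (q^ c ^ j ⊛ B n j))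
                      ≈ ⊖ q^ (β + c * n) ⊛ r n j
      r-term₀ j = flip-term (expo j n) (β + c * n) (B n j) (sgn-+suc j n)
                            (trans (sym (expo-suc-n j n)) (+-assoc (expo j n) β (c * n)))

      r-term₁ : ∀ j → const (sgn (j + suc n)) ⊛ (q^ expo j (suc n) ⊛ (X ⊛ prev (B n) j)) ≈ X ⊛ prev (r n) j
      r-term₁ zero = both-𝟘 (vanish₃ (const (sgn (suc n))) (q^ expo 0 (suc n)) X (λ _ → refl)) (⊛-zeroʳ X)
      r-term₁ (suc j) i = trans (⊛-congʳ (q^ expo j n ⊛ (X ⊛ B n j)) sign i)
        (solve 4 (λ s m x b → s :* (m :* (x :* b)) := x :* (s :* (m :* b))) (λ _ → refl)
               (const (sgn (j + n))) (q^ expo j n) X (B n j) i)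
        where
        sign : const (sgn (suc j + suc n)) ≈ const (sgn (j + n))
        sign i = cong (λ x → const x i) (trans (cong -F_ (sgn-+suc j n)) (-F-involutive (sgn (j + n))))

      r-term₂ : ∀ j → const (sgn (j + suc n)) ⊛
                        (q^ expo j (suc n) ⊛ (q^ c ^ (2 + (n + n) ∸ j) ⊛ prev (prev (B n)) j))
                      ≈ ⊖ q^ (α + c * n) ⊛ prev (prev (r n)) j
      r-term₂ 0 = both-𝟘 (vanish₃ (const (sgn (suc n))) (q^ expo 0 (suc n)) _ (λ _ → refl))
                         (⊛-zeroʳ (⊖ q^ (α + c * n)))
      r-term₂ 1 = both-𝟘 (vanish₃ (const (sgn (2 + n))) (q^ expo 1 (suc n)) _ (λ _ → refl))
                         (⊛-zeroʳ (⊖ q^ (α + c * n)))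
      r-term₂ (suc (suc j)) with j ≤? n + n
      ... | no  j≰2n =
        both-𝟘 (vanish₃ (const (sgn (2 + j + suc n))) (q^ expo (suc j) n) _ (B-vanishes n j (≰⇒> j≰2n)))
               (⊛-vanishesʳ (⊖ q^ (α + c * n)) (r-vanishes n j (≰⇒> j≰2n)))
      ... | yes j≤2n = flip-term (expo j n) (α + c * n) (B n j) (trans (sgn-2+ (j + suc n)) (sgn-+suc j n))
                                 (trans (expo-mirror j n j≤2n) (+-assoc (expo j n) α (c * n)))

    r-recurrence : ∀ n j → r (suc n) j ≈ ⊖ q^ (β + c * n) ⊛ r n j ⊕ X n ⊛ prev (r n) j
                                         ⊕ ⊖ q^ (α + c * n) ⊛ prev (prev (r n)) j
    r-recurrence n j i = trans
      (solve 5 (λ s m x y z → s :* (m :* (x :+ y :+ z)) := s :* (m :* x) :+ s :* (m :* y) :+ s :* (m :* z))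
               (λ _ → refl)
             (const (sgn (j + suc n))) (q^ expo j (suc n))
             (q^ c ^ j ⊛ B n j) (X n ⊛ prev (B n) j) (q^ c ^ (2 + (n + n) ∸ j) ⊛ prev (prev (B n)) j) i)
      (⊕-cong (⊕-cong (r-term₀ n j) (r-term₁ n j)) (r-term₂ n j) i)

    Θ≤ : ℕ → Series
    Θ≤ n = ∑< (r n) (suc (n + n))

    pair : ℕ → Series
    pair i = 1-q^ (α + c * i) ⊛ 1-q^ (β + c * i)

    Π≤ : ℕ → Series
    Π≤ = ∏≤ (pair ∘ pred)

    Θ≤-step : ∀ n → Θ≤ (suc n) ≈ pair n ⊛ Θ≤ n
    Θ≤-step n = begin
      ∑< (r (suc n)) L
        ≈⟨ ∑<-cong L (r-recurrence n) ⟩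
      ∑< (λ j → ⊖ p ⊛ r n j ⊕ X n ⊛ prev (r n) j ⊕ ⊖ p′ ⊛ prev (prev (r n)) j) L
        ≈⟨ split ⟩
      ⊖ p ⊛ ∑< (r n) L ⊕ X n ⊛ ∑< (prev (r n)) L ⊕ ⊖ p′ ⊛ ∑< (prev (prev (r n))) L
        ≈⟨ ⊕-cong (⊕-cong (⊛-congˡ (⊖ p) sum₀) (⊛-congˡ (X n) sum₁)) (⊛-congˡ (⊖ p′) sum₂) ⟩
      ⊖ p ⊛ Θ≤ n ⊕ X n ⊛ Θ≤ n ⊕ ⊖ p′ ⊛ Θ≤ n
        ≈⟨ ⊕-congʳ (⊖ p′ ⊛ Θ≤ n) (⊕-congˡ (⊖ p ⊛ Θ≤ n)
                                          (⊛-congʳ (Θ≤ n) (⊕-congˡ 𝟙 X-factors))) ⟩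
      ⊖ p ⊛ Θ≤ n ⊕ (𝟙 ⊕ p′ ⊛ p) ⊛ Θ≤ n ⊕ ⊖ p′ ⊛ Θ≤ n
        ≈⟨ solve 3 (λ p p′ t → (:- p) :* t :+ (con 1F :+ p′ :* p) :* t :+ (:- p′) :* t
                             := ((con 1F :- p′) :* (con 1F :- p)) :* t) (λ _ → refl) p p′ (Θ≤ n) ⟩
      (1-q^ (α + c * n) ⊛ 1-q^ (β + c * n)) ⊛ Θ≤ n ∎
      where
      open ≈-Reasoning
      L : ℕ
      L = suc (suc n + suc n)
      p p′ : Series
      p = q^ (β + c * n)
      p′ = q^ (α + c * n)
      split : ∑< (λ j → ⊖ p ⊛ r n j ⊕ X n ⊛ prev (r n) j ⊕ ⊖ p′ ⊛ prev (prev (r n)) j) L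
              ≈ ⊖ p ⊛ ∑< (r n) L ⊕ X n ⊛ ∑< (prev (r n)) L ⊕ ⊖ p′ ⊛ ∑< (prev (prev (r n))) L
      split i = trans (∑<-⊕ (λ j → ⊖ p ⊛ r n j ⊕ X n ⊛ prev (r n) j)
                            (λ j → ⊖ p′ ⊛ prev (prev (r n)) j) L i)
        (cong₂ _+F_ (trans (∑<-⊕ (λ j → ⊖ p ⊛ r n j) (λ j → X n ⊛ prev (r n) j) L i)
                           (cong₂ _+F_ (∑<-⊛ (⊖ p) (r n) L i) (∑<-⊛ (X n) (prev (r n)) L i)))
                    (∑<-⊛ (⊖ p′) (prev (prev (r n))) L i))
      tail-vanishes : ∀ j → suc (n + n) ≤ j → r n j ≈ 𝟘
      tail-vanishes j = r-vanishes n j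
      sum₀ : ∑< (r n) L ≈ Θ≤ n
      sum₀ i = trans (cong (λ m → ∑< (r n) m i) (L≡ n)) (∑<-extend (r n) (suc (n + n)) 2 tail-vanishes i)
        where
        L≡ : ∀ n → suc (suc n + suc n) ≡ suc (n + n) + 2
        L≡ = solve-∀
      sum₁ : ∑< (prev (r n)) L ≈ Θ≤ n
      sum₁ i = trans (cong (λ m → ∑< (r n) m i) (L≡ n)) (∑<-extend (r n) (suc (n + n)) 1 tail-vanishes i)
        where
        L≡ : ∀ n → suc n + suc n ≡ suc (n + n) + 1
        L≡ = solve-∀
      sum₂ : ∑< (prev (prev (r n))) L ≈ Θ≤ n
      sum₂ i = cong (λ m → ∑< (r n) m i) (+-suc n n)
      X-factors : q^ c ^ suc (n + n) ≈ p′ ⊛ p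
      X-factors i = trans (q^-^ c (suc (n + n)) i) (q^-split (α + c * n) (β + c * n) (exponents α β n) i)
        where
        exponents : ∀ α β n → (α + β) * suc (n + n) ≡ (α + (α + β) * n) + (β + (α + β) * n)
        exponents = solve-∀

    finite-triple-product : ∀ n → Π≤ n ≈ Θ≤ n
    finite-triple-product zero i = sym (trans (+F-identityʳ _) (trans (const-⊛ 1F _ i) (trans (*F-identityˡ _)
      (trans (⊛-congʳ 𝟙 (λ i′ → trans (cong (λ e → (q^ e) i′) expo-0-0) (q^0 i′)) i)
             (⊛-identityˡ 𝟙 i)))))
      where
      expo-0-0 : expo 0 0 ≡ 0
      expo-0-0 = cong₂ _+_ (*-zeroʳ α) (*-zeroʳ β)
    finite-triple-product (suc n) i =
      trans (⊛-comm (Π≤ n) _ i) (trans (⊛-congˡ _ (finite-triple-product n) i) (sym (Θ≤-step n i)))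

  δ : ℕ → ℕ → ℕ
  δ x y = if x ≡ᵇ y then 1 else 0

  -- The exponent of 1 - q^j in ∏_{i ≥ 1} (1 - q^(c i)) (1 - q^(c i - α)) (1 - q^(c i - β)), where c = α + β.
  jacobi-exponent : ℕ → ℕ → ℕ → ℕ
  jacobi-exponent a b j = δ (j % c) 0 + δ (j % c) (suc a) + δ (j % c) (suc b)
    where c = suc a + suc b

  module TripleProduct (a b : ℕ) where

    α β : ℕ
    α = suc a
    β = suc b

    open FiniteTripleProduct α β

    onResidue : ℕ → ℕ → ℕ
    onResidue s j = δ (j % c) s

    -- P∞ = (q^c; q^c)_∞ and G∞ = 1 / P∞.
    P∞ G∞ : Series
    P∞ = Π (onResidue 0) (λ _ → 0)
    G∞ = Π (λ _ → 0) (onResidue 0)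

    P∞⊛G∞ : P∞ ⊛ G∞ ≈ 𝟙
    P∞⊛G∞ i = trans (Π-⊛ (onResidue 0) (λ _ → 0) (λ _ → 0) (onResidue 0) i)
      (trans (Π-cong (λ j → onResidue 0 j + 0) (λ j → 0 + onResidue 0 j) (λ _ → 0) (λ _ → 0)
                     (λ j → trans (+-identityʳ _) (+-identityʳ _)) i)
             (Π-0-0 i))

    residue-block : ∀ s → 1 ≤ s → s ≤ c → ∀ i →
                    block (factors (onResidue (s % c)) (λ _ → 0)) (c * i) c ≈ 1-q^ (c * i + s)
    residue-block s 1≤s s≤c i n =
      trans (block-single u (c * i) c s 1≤s s≤c trivial n)
            (trans (cong (λ e → factor (c * i + s) e 0 n)
                         (trans (cong (λ t → δ t (s % c)) (residue s)) (δ-refl (s % c))))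
                   (trans (⊛-identityʳ (1-q^ (c * i + s) ^ 1) n) (⊛-identityʳ (1-q^ (c * i + s)) n)))
      where
      u : ℕ → Series
      u = factors (onResidue (s % c)) (λ _ → 0)
      residue : ∀ r → (c * i + r) % c ≡ r % c
      residue r = trans (cong (_% c) (trans (+-comm (c * i) r) (cong (r +_) (*-comm c i)))) ([m+kn]%n≡m%n r i c)
      δ-refl : ∀ x → δ x x ≡ 1
      δ-refl zero    = refl
      δ-refl (suc x) = δ-refl x
      δ-≢ : ∀ {x y} → x ≢ y → δ x y ≡ 0
      δ-≢ {zero}  {zero}  x≢y = contradiction refl x≢y
      δ-≢ {zero}  {suc y} _   = refl
      δ-≢ {suc x} {zero}  _   = refl
      δ-≢ {suc x} {suc y} x≢y = δ-≢ (x≢y ∘ cong suc)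
      small : ∀ {r} → r ≤ c → r ≢ c → r % c ≡ r
      small r≤c r≢c = m<n⇒m%n≡m (≤∧≢⇒< r≤c r≢c)
      %-injective : ∀ {r s} → 1 ≤ r → r ≤ c → 1 ≤ s → s ≤ c → r % c ≡ s % c → r ≡ s
      %-injective {r} {s} 1≤r r≤c 1≤s s≤c eq with r ≟ c | s ≟ c
      ... | yes refl | yes refl = refl
      ... | yes refl | no  s≢c  = contradiction (trans (sym (trans (sym eq) (n%n≡0 c))) (small s≤c s≢c)) (<⇒≢ 1≤s)
      ... | no  r≢c  | yes refl = contradiction (trans (sym (trans eq (n%n≡0 c))) (small r≤c r≢c)) (<⇒≢ 1≤r)
      ... | no  r≢c  | no  s≢c  = trans (sym (small r≤c r≢c)) (trans eq (small s≤c s≢c))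
      trivial : ∀ r → 1 ≤ r → r ≤ c → r ≢ s → u (c * i + r) ≈ 𝟙
      trivial r 1≤r r≤c r≢s n′ =
        trans (cong (λ e → factor (c * i + r) e 0 n′) (trans (cong (λ t → δ t (s % c)) (residue r))
                                                             (δ-≢ (r≢s ∘ %-injective 1≤r r≤c 1≤s s≤c))))
              (factor-0-0 (c * i + r) n′)

    [_]!-≈[] : ∀ m {M} → M ≤ c * m → [ m ]! ≈[ M ] P∞
    [ m ]!-≈[] {M} M≤cm =
      ≈[]-sym (≈[]-trans (∏-≈[] u (factors-converge (onResidue 0) (λ _ → 0)) (c * m) M≤cm)
                         (≈⇒≈[] (λ i → trans (∏≤-blocks c blocks m i) (sym ([]!-∏≤ m i)))))
      where
      u : ℕ → Series
      u = factors (onResidue 0) (λ _ → 0)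
      blocks : ∀ i → block u (c * i) c ≈ 1-q^ (c * suc i)
      blocks i n = trans (cong (λ r → block (factors (onResidue r) (λ _ → 0)) (c * i) c n) (sym (n%n≡0 c)))
        (trans (residue-block c (s≤s z≤n) ≤-refl i n)
               (cong (λ e → (1-q^ e) n) (trans (+-comm (c * i) c) (sym (*-suc c i)))))
      []!-∏≤ : ∀ m → [ m ]! ≈ ∏≤ (λ i → 1-q^ (c * i)) m
      []!-∏≤ zero    = λ _ → refl
      []!-∏≤ (suc m) = ⊛-cong ([]!-∏≤ m) (⊕-congˡ 𝟙 (⊖-cong (q^-^ c (suc m))))

    B-≈[] : ∀ n j {M} → j ≤ n + n → M ≤ c * j → M ≤ c * (n + n ∸ j) → B n j ≈[ M ] G∞
    B-≈[] n j {M} j≤2n M≤cj M≤c[2n-j] =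
      ≈[]-trans (≈⇒≈[] insert-units)
      (≈[]-trans (⊛-cong-≈[] (⊛-cong-≈[] {f = B n j} (λ _ _ → refl)
                                         (≈[]-sym (⊛-cong-≈[] ([ j ]!-≈[] M≤cj) ([ n + n ∸ j ]!-≈[] M≤c[2n-j]))))
                              (λ _ _ → refl))
      (≈[]-trans (≈⇒≈[] (⊛-congʳ (G∞ ⊛ G∞) (B-factorial n j (n + n ∸ j) (m+[n∸m]≡n j≤2n))))
      (≈[]-trans (⊛-cong-≈[] ([ n + n ]!-≈[] (≤-trans M≤cj (*-monoʳ-≤ c j≤2n))) (λ _ _ → refl))
                 (≈⇒≈[] cancel))))
      where
      insert-units : B n j ≈ (B n j ⊛ (P∞ ⊛ P∞)) ⊛ (G∞ ⊛ G∞)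
      insert-units i = trans (sym (⊛-identityʳ (B n j) i))
        (trans (⊛-congˡ (B n j) (λ i′ → sym (trans (⊛-cong P∞⊛G∞ P∞⊛G∞ i′) (⊛-identityˡ 𝟙 i′)))
                        i)
               (solve 3 (λ b p g → b :* ((p :* g) :* (p :* g)) := (b :* (p :* p)) :* (g :* g)) (λ _ → refl)
                      (B n j) P∞ G∞ i))
      cancel : P∞ ⊛ (G∞ ⊛ G∞) ≈ G∞
      cancel i = trans (sym (⊛-assoc P∞ G∞ G∞ i)) (trans (⊛-congʳ G∞ P∞⊛G∞ i) (⊛-identityˡ G∞ i))

    w′ : ℕ → ℕ
    w′ j = onResidue α j + onResidue β j

    Π≤-≈[] : ∀ n {M} → M ≤ c * n → Π≤ n ≈[ M ] Π w′ (λ _ → 0)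
    Π≤-≈[] n {M} M≤cn =
      ≈[]-sym (≈[]-trans (∏-≈[] (factors w′ (λ _ → 0)) (factors-converge w′ (λ _ → 0)) (c * n) M≤cn)
                         (≈⇒≈[] (∏≤-blocks c blocks n)))
      where
      single : ∀ s → 1 ≤ s → s < c → ∀ i →
               block (factors (onResidue s) (λ _ → 0)) (c * i) c ≈ 1-q^ (s + c * i)
      single s 1≤s s<c i n =
        trans (cong (λ r → block (factors (onResidue r) (λ _ → 0)) (c * i) c n) (sym (m<n⇒m%n≡m s<c)))
              (trans (residue-block s 1≤s (<⇒≤ s<c) i n) (cong (λ e → (1-q^ e) n) (+-comm (c * i) s)))
      blocks : ∀ i → block (factors w′ (λ _ → 0)) (c * i) c ≈ pair i
      blocks i n = trans (block-cong (c * i) c (λ j n′ → sym (factor-⊛ j (onResidue α j) 0 (onResidue β j) 0 n′)) n)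
        (trans (block-⊛ (factors (onResidue α) (λ _ → 0)) (factors (onResidue β) (λ _ → 0)) (c * i) c n)
               (⊛-cong (single α (s≤s z≤n) (m<m+n α (s≤s z≤n)) i)
                       (single β (s≤s z≤n) (m<n+m β (s≤s z≤n)) i) n))

    θ-up θ-down : ℕ → Series
    θ-up   k = const (sgn k) ⊛ (q^ e⁺ α β k ⊛ G∞)
    θ-down k = ⊖ (const (sgn k) ⊛ (q^ e⁻ α β k ⊛ G∞))

    Θ⊛G∞-≈[] : ∀ {M} L → M < L → Θ α β ⊛ G∞ ≈[ M ] ∑< θ-up L ⊕ ∑< θ-down L
    Θ⊛G∞-≈[] {M} L M<L = ≈[]-trans (⊛-cong-≈[] truncate (λ _ _ → refl)) (≈⇒≈[] distribute)
      where
      truncate : Θ α β ≈[ M ] ∑< (θ-term α β) L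
      truncate i i≤M = sym (∑-∑< (θ-term-summable α β (s≤s z≤n)) i L (≤-<-trans i≤M M<L))
      distribute : ∑< (θ-term α β) L ⊛ G∞ ≈ ∑< θ-up L ⊕ ∑< θ-down L
      distribute i = trans (⊛-comm (∑< (θ-term α β) L) G∞ i) (trans (sym (∑<-⊛ G∞ (θ-term α β) L i))
        (trans (∑<-cong L (λ k → solve 4 (λ g s x y → g :* (s :* (x :- y)) := s :* (x :* g) :+ (:- (s :* (y :* g))))
                                         (λ _ → refl) G∞ (const (sgn k)) (q^ e⁺ α β k) (q^ e⁻ α β k)) i)
               (∑<-⊕ θ-up θ-down L i)))

    Θ≤-split : ∀ n → Θ≤ n ≈ ∑< (λ k → r n (n + k)) (suc n) ⊕ ∑< (λ k → r n (n ∸ suc k)) n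
    Θ≤-split n i = trans (cong (λ m → ∑< (r n) m i) (sym (+-suc n n)))
      (trans (∑<-+ (r n) n (suc n) i)
      (trans (cong (_+F up i) (∑<-reverse (r n) n i)) (+F-comm (down i) (up i))))
      where
      up down : Series
      up   = ∑< (λ k → r n (n + k)) (suc n)
      down = ∑< (λ k → r n (n ∸ suc k)) n

    private
      sgn-up : ∀ n k → sgn (n + k + n) ≡ sgn k
      sgn-up zero    k = cong sgn (+-identityʳ k)
      sgn-up (suc n) k = trans (cong (-F_ ∘ sgn) (+-suc (n + k) n)) (trans (-F-involutive _) (sgn-up n k))

      sgn-down : ∀ j k → sgn (j + (j + suc k)) ≡ -F sgn k
      sgn-down zero    k = refl
      sgn-down (suc j) k = trans (cong (-F_ ∘ sgn) (+-suc j (j + suc k))) (trans (-F-involutive _) (sgn-down j k))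

    r-up : ∀ n k → r n (n + k) ≈ const (sgn k) ⊛ (q^ e⁺ α β k ⊛ B n (n + k))
    r-up n k = ⊛-cong (λ i → cong (λ s → const s i) (sgn-up n k))
                      (⊛-congʳ (B n (n + k)) (λ i → cong (λ e → (q^ e) i) (expo-up n k)))

    r-down : ∀ n k → k < n → r n (n ∸ suc k) ≈ ⊖ (const (sgn k) ⊛ (q^ e⁻ α β k ⊛ B n (n ∸ suc k)))
    r-down n k k<n i = trans (⊛-cong sign (⊛-congʳ (B n j) exponent) i)
      (solve 2 (λ s y → (:- s) :* y := :- (s :* y)) (λ _ → refl) (const (sgn k)) (q^ e⁻ α β k ⊛ B n j) i)
      where
      j : ℕ
      j = n ∸ suc k
      j+1+k≡n : j + suc k ≡ n
      j+1+k≡n = m∸n+n≡m k<n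
      sign : const (sgn (j + n)) ≈ ⊖ const (sgn k)
      sign i = trans (cong (λ m → const (sgn (j + m)) i) (sym j+1+k≡n))
                     (trans (cong (λ s → const s i) (sgn-down j k)) (const-⊖ (sgn k) i))
      exponent : q^ expo j n ≈ q^ e⁻ α β k
      exponent i = cong (λ e → (q^ e) i) (trans (cong (expo j) (sym j+1+k≡n)) (expo-down j k))

    -- With n = 2M + 1 the finite identity Π≤ n = Θ≤ n already fixes all coefficients of degree ≤ M: the terms
    -- with k ≤ M carry binomials that agree with G∞ up to degree M, and the other terms start beyond q^M.
    module Limit (M : ℕ) where

      n : ℕ
      n = suc (M + M)

      private
        c≥ : ∀ x → x ≤ c * x
        c≥ x = m≤n*m x c

        tail-≈[] : ∀ s e f → M < e → const s ⊛ (q^ e ⊛ f) ≈[ M ] 𝟘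
        tail-≈[] s e f M<e i i≤M =
          trans (const-⊛ s _ i) (trans (cong (s *F_) (q^⊛-< e f (≤-<-trans i≤M M<e))) (*F-zeroʳ s))

      up-≈[] : ∀ k → k < suc n → r n (n + k) ≈[ M ] θ-up k
      up-≈[] k k≤n with k ≤? M
      ... | yes k≤M = ≈[]-trans (≈⇒≈[] (r-up n k))
        (⊛-cong-≈[] (λ _ _ → refl) (⊛-cong-≈[] (λ _ _ → refl) (B-≈[] n (n + k) n+k≤2n M≤c[n+k] M≤c[n-k])))
        where
        n+k≤2n : n + k ≤ n + n
        n+k≤2n = +-monoʳ-≤ n (≤-pred k≤n)
        M≤c[n+k] : M ≤ c * (n + k)
        M≤c[n+k] = ≤-trans (≤-trans (m≤m+n M M) (≤-trans (n≤1+n (M + M)) (m≤m+n n k))) (c≥ (n + k))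
        M≤c[n-k] : M ≤ c * (n + n ∸ (n + k))
        M≤c[n-k] = ≤-trans (≤-trans (m+n≤o⇒m≤o∸n M (≤-trans (+-monoʳ-≤ M k≤M) (n≤1+n (M + M))))
                                    (≤-reflexive (sym ([m+n]∸[m+o]≡n∸o n n k)))) (c≥ _)
      ... | no  k≰M = ≈[]-trans (≈⇒≈[] (r-up n k))
                                (≈[]-trans (tail-≈[] (sgn k) (e⁺ α β k) (B n (n + k)) M<e⁺)
                                           (≈[]-sym (tail-≈[] (sgn k) (e⁺ α β k) G∞ M<e⁺)))
        where
        M<e⁺ : M < e⁺ α β k
        M<e⁺ = <-≤-trans (≰⇒> k≰M) (e⁺-≥ α β (s≤s z≤n) k)

      down-≈[] : ∀ k → k < n → r n (n ∸ suc k) ≈[ M ] θ-down k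
      down-≈[] k k<n with k ≤? M
      ... | yes k≤M = ≈[]-trans (≈⇒≈[] (r-down n k k<n))
                                (λ i i≤M → cong -F_ (⊛-cong-≈[] (λ _ _ → refl) (⊛-cong-≈[] (λ _ _ → refl)
                                  (B-≈[] n j j≤2n M≤cj M≤c[2n-j])) i i≤M))
        where
        j : ℕ
        j = n ∸ suc k
        j≤n : j ≤ n
        j≤n = m∸n≤m n (suc k)
        j≤2n : j ≤ n + n
        j≤2n = ≤-trans j≤n (m≤m+n n n)
        M≤cj : M ≤ c * j
        M≤cj = ≤-trans (m+n≤o⇒m≤o∸n M (≤-trans (+-monoʳ-≤ M (s≤s k≤M)) (≤-reflexive (+-suc M M))))
                       (c≥ j)
        M≤c[2n-j] : M ≤ c * (n + n ∸ j)
        M≤c[2n-j] = ≤-trans (≤-trans (≤-trans (m≤m+n M M) (n≤1+n (M + M)))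
                                     (≤-trans (≤-reflexive (sym (m+n∸n≡m n n))) (∸-monoʳ-≤ (n + n) j≤n))) (c≥ _)
      ... | no  k≰M = ≈[]-trans (≈⇒≈[] (r-down n k k<n)) λ i i≤M →
        trans (cong -F_ (tail-≈[] (sgn k) (e⁻ α β k) (B n (n ∸ suc k)) M<e⁻ i i≤M))
              (sym (cong -F_ (tail-≈[] (sgn k) (e⁻ α β k) G∞ M<e⁻ i i≤M)))
        where
        M<e⁻ : M < e⁻ α β k
        M<e⁻ = <-≤-trans (≰⇒> k≰M) (e⁻-≥ α β (s≤s z≤n) k)

      last-≈[] : θ-down n ≈[ M ] 𝟘
      last-≈[] i i≤M =
        cong -F_ (tail-≈[] (sgn n) (e⁻ α β n) G∞ (<-≤-trans (s≤s (m≤m+n M M)) (e⁻-≥ α β (s≤s z≤n) n))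
                           i i≤M)

      Θ⊛G∞-≈[]-Π : Θ α β ⊛ G∞ ≈[ M ] Π w′ (λ _ → 0)
      Θ⊛G∞-≈[]-Π = ≈[]-trans (Θ⊛G∞-≈[] (suc n) (s≤s (≤-trans (m≤m+n M M) (n≤1+n (M + M)))))
        (≈[]-trans termwise
        (≈[]-trans (≈⇒≈[] (λ i → trans (sym (Θ≤-split n i)) (sym (finite-triple-product n i))))
                   (Π≤-≈[] n (≤-trans (n≤1+n M) (≤-trans (s≤s (m≤m+n M M)) (c≥ n))))))
        where
        termwise : ∑< θ-up (suc n) ⊕ ∑< θ-down (suc n)
                   ≈[ M ] ∑< (λ k → r n (n + k)) (suc n) ⊕ ∑< (λ k → r n (n ∸ suc k)) n
        termwise i i≤M = cong₂ _+F_
          (sym (∑<-cong-≈[] (suc n) up-≈[] i i≤M))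
          (trans (∑<-last θ-down n i)
                 (trans (cong₂ _+F_ (sym (∑<-cong-≈[] n down-≈[] i i≤M)) (last-≈[] i i≤M))
                        (+F-identityʳ _)))

    Θ⊛G∞ : Θ α β ⊛ G∞ ≈ Π w′ (λ _ → 0)
    Θ⊛G∞ M = Limit.Θ⊛G∞-≈[]-Π M M ≤-refl

    triple-product : Θ α β ≈ Π (jacobi-exponent a b) (λ _ → 0)
    triple-product = begin
      Θ α β
        ≈⟨ ⊛-identityʳ (Θ α β) ⟨
      Θ α β ⊛ 𝟙
        ≈⟨ ⊛-congˡ (Θ α β) (λ i → trans (⊛-comm G∞ P∞ i) (P∞⊛G∞ i)) ⟨
      Θ α β ⊛ (G∞ ⊛ P∞)
        ≈⟨ ⊛-assoc (Θ α β) G∞ P∞ ⟨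
      (Θ α β ⊛ G∞) ⊛ P∞
        ≈⟨ ⊛-congʳ P∞ Θ⊛G∞ ⟩
      Π w′ (λ _ → 0) ⊛ P∞
        ≈⟨ Π-⊛ w′ (λ _ → 0) (onResidue 0) (λ _ → 0) ⟩
      Π (λ j → w′ j + onResidue 0 j) (λ _ → 0)
        ≈⟨ Π-cong (λ j → w′ j + onResidue 0 j) (λ _ → 0) (jacobi-exponent a b) (λ _ → 0) (λ j →
                  regroup (onResidue α (suc j)) (onResidue β (suc j)) (onResidue 0 (suc j))) ⟩
      Π (jacobi-exponent a b) (λ _ → 0) ∎
      where
      open ≈-Reasoning
      regroup : ∀ x y z → (x + y + z) + 0 ≡ z + x + y + (0 + 0)
      regroup = solve-∀

open import Data.Bool using (true; false; if_then_else_)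
open import Data.Fin using (Fin; toℕ; fromℕ<)
open import Data.Fin.Properties using (all?; toℕ-fromℕ<)
open import Data.Nat as ℕ using (zero; suc; _<_; _%_; _/_; _≟_; _≡ᵇ_; NonZero)
open import Data.Nat.DivMod
  using (m%n<n; m%n%n≡m%n; m≡m%n+[m/n]*n; [m+kn]%n≡m%n; m∣n⇒o%n%m≡o%m; [m+n]%n≡m%n)
open import Data.Nat.Divisibility using (divides; *-monoʳ-∣; m%n≡0⇒n∣m; n∣m⇒m%n≡0)
open import Data.Nat.Properties using (+-identityʳ; +-comm; *-comm; *-zeroʳ)
open import Data.Nat.Tactic.RingSolver using (solve-∀)
open import Data.Product using (_×_; _,_)
open import Data.Sum using (_⊎_; inj₁; inj₂)
open import Function using (_∘_)
open import Relation.Binary.PropositionalEquality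
  using (_≡_; _≢_; refl; sym; trans; cong; cong₂; subst; module ≡-Reasoning)
open import Relation.Nullary using (yes; no; contradiction)
open import Relation.Nullary.Decidable using (from-yes; _⊎-dec_; _×-dec_)

open 𝔽₃ using (mod3≡0⇒3∣)
open PowerSeries
open EtaProducts
open PartitionSeries using (a-mod3)
open ThetaSeries
open JacobiTripleProduct using (δ; jacobi-exponent; module TripleProduct)

by-residue : ∀ {n} (P : ℕ → Set) → (∀ (i : Fin n) → P (toℕ i)) → ∀ r → r < n → P r
by-residue P all r r<n = subst P (toℕ-fromℕ< r<n) (all (fromℕ< r<n))

Θ-1-1 : Θ 1 1 ≈ Π (jacobi-exponent 0 0) (λ _ → 0)
Θ-1-1 = TripleProduct.triple-product 0 0

Θ-15-3 : Θ 15 3 ≈ Π (jacobi-exponent 14 2) (λ _ → 0)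
Θ-15-3 = TripleProduct.triple-product 14 2

Θ-3-3 : Θ 3 3 ≈ Π (jacobi-exponent 2 2) (λ _ → 0)
Θ-3-3 = TripleProduct.triple-product 2 2

stretch₃-const : ∀ e j → stretch₃ (λ _ → e) j ≡ δ (j % 3) 0 * e
stretch₃-const e zero                = sym (+-identityʳ e)
stretch₃-const e (suc zero)          = refl
stretch₃-const e (suc (suc zero))    = refl
stretch₃-const e (suc (suc (suc j))) =
  trans (stretch₃-const e j) (cong (λ r → δ r 0 * e) (sym (trans (cong (_% 3) (+-comm 3 j)) ([m+n]%n≡m%n j 3))))

-- (q^3; q^3)_∞^(-2)
P₆ : Series
P₆ = Π (stretch₃ (λ _ → 0)) (stretch₃ (λ _ → 2))

P₆-supported : Supported 3 P₆
P₆-supported = Π-supported 3 (stretch₃ (λ _ → 0)) (stretch₃ (λ _ → 2)) per-factor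
  where
  per-factor : ∀ m → Supported 3 (factor (suc m) (stretch₃ (λ _ → 0) (suc m)) (stretch₃ (λ _ → 2) (suc m)))
  per-factor m with suc m % 3 ≟ 0
  ... | yes 3∣m+1 = factor-supported 3 m (stretch₃ (λ _ → 0) (suc m)) (stretch₃ (λ _ → 2) (suc m)) 3∣m+1
  ... | no  3∤m+1 =
    supported-cong 3 (λ n → sym (trans (cong₂ (λ x y → factor (suc m) x y n) (exponent 0) (exponent 2))
                                       (factor-0-0 (suc m) n)))
                     (𝟙-supported 3)
    where
    δ-≢ : ∀ {x} → x ≢ 0 → δ x 0 ≡ 0
    δ-≢ {zero}  x≢0 = contradiction refl x≢0
    δ-≢ {suc x} _   = refl
    exponent : ∀ e → stretch₃ (λ _ → e) (suc m) ≡ 0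
    exponent e = trans (stretch₃-const e (suc m)) (cong (_* e) (δ-≢ 3∤m+1))

-- The exponents of V₉ = Θ(15,3) P₆ / Θ(3,3), which depend only on j mod 18.
v₉ : ℕ → ℕ
v₉ r = if r ≡ᵇ 0 then 2 else if r ≡ᵇ 9 then 4 else if r % 3 ≡ᵇ 0 then 3 else 0

V₉ : Series
V₉ = Π (λ _ → 0) (λ j → v₉ (j % 18))

private
  mod-18 : ∀ d .{{_ : NonZero d}} → d ∣ 18 → ∀ x → x % 18 % d ≡ x % d
  mod-18 d d∣18 x = m∣n⇒o%n%m≡o%m d 18 x d∣18

  J₁₅₃ J₃₃ : ℕ → ℕ
  J₁₅₃ = jacobi-exponent 14 2
  J₃₃  = jacobi-exponent 2 2

V₉-exponents-on-residues : ∀ r → r < 18 → J₁₅₃ r + v₉ r ≡ J₃₃ r + δ (r % 3) 0 * 2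
V₉-exponents-on-residues = by-residue {18} _ (from-yes (all? λ (i : Fin 18) →
  J₁₅₃ (toℕ i) + v₉ (toℕ i) ≟ J₃₃ (toℕ i) + δ (toℕ i % 3) 0 * 2))

V₉-exponents : ∀ x → (J₁₅₃ x + stretch₃ (λ _ → 0) x) + (0 + v₉ (x % 18))
                   ≡ (J₃₃ x + 0) + (0 + stretch₃ (λ _ → 2) x)
V₉-exponents x = begin
  (J₁₅₃ x + stretch₃ (λ _ → 0) x) + (0 + v₉ (x % 18))
    ≡⟨ cong (λ e → (J₁₅₃ x + e) + v₉ (x % 18)) (trans (stretch₃-const 0 x) (*-zeroʳ (δ (x % 3) 0))) ⟩
  (J₁₅₃ x + 0) + v₉ (x % 18)
    ≡⟨ cong (_+ v₉ (x % 18)) (+-identityʳ (J₁₅₃ x)) ⟩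
  J₁₅₃ x + v₉ (x % 18)
    ≡⟨ cong (λ r → δ r 0 + δ r 15 + δ r 3 + v₉ (x % 18)) (m%n%n≡m%n x 18) ⟨
  J₁₅₃ (x % 18) + v₉ (x % 18)
    ≡⟨ V₉-exponents-on-residues (x % 18) (m%n<n x 18) ⟩
  J₃₃ (x % 18) + δ (x % 18 % 3) 0 * 2
    ≡⟨ cong₂ (λ r s → δ r 0 + δ r 3 + δ r 3 + δ s 0 * 2) (mod-18 6 (divides 3 refl) x)
                                                     (mod-18 3 (divides 6 refl) x) ⟩
  J₃₃ x + δ (x % 3) 0 * 2
    ≡⟨ cong₂ _+_ (+-identityʳ (J₃₃ x)) (stretch₃-const 2 x) ⟨
  (J₃₃ x + 0) + (0 + stretch₃ (λ _ → 2) x) ∎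
  where open ≡-Reasoning

Θ-15-3⊛P₆ : Θ 15 3 ⊛ P₆ ≈ Θ 3 3 ⊛ V₉
Θ-15-3⊛P₆ = begin
  Θ 15 3 ⊛ P₆
    ≈⟨ ⊛-congʳ P₆ Θ-15-3 ⟩
  Π J₁₅₃ (λ _ → 0) ⊛ P₆
    ≈⟨ Π-⊛ J₁₅₃ (λ _ → 0) (stretch₃ (λ _ → 0)) (stretch₃ (λ _ → 2)) ⟩
  Π (λ j → J₁₅₃ j + stretch₃ (λ _ → 0) j) (λ j → 0 + stretch₃ (λ _ → 2) j)
    ≈⟨ Π-cong (λ j → J₁₅₃ j + stretch₃ (λ _ → 0) j) (λ j → 0 + stretch₃ (λ _ → 2) j)
              (λ j → J₃₃ j + 0) (λ j → 0 + v₉ (j % 18)) (V₉-exponents ∘ suc) ⟩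
  Π (λ j → J₃₃ j + 0) (λ j → 0 + v₉ (j % 18))
    ≈⟨ Π-⊛ J₃₃ (λ _ → 0) (λ _ → 0) (λ j → v₉ (j % 18)) ⟨
  Π J₃₃ (λ _ → 0) ⊛ V₉
    ≈⟨ ⊛-congʳ V₉ Θ-3-3 ⟨
  Θ 3 3 ⊛ V₉ ∎
  where open ≈-Reasoning

V₉-supported : Supported 9 V₉
V₉-supported = Π-supported 9 (λ _ → 0) (λ j → v₉ (j % 18)) per-factor
  where
  classes : ∀ r → r < 18 → r % 9 ≡ 0 ⊎ (r % 3 ≡ 0 × v₉ r ≡ 3) ⊎ v₉ r ≡ 0
  classes = by-residue {18} _ (from-yes (all? λ (i : Fin 18) →
    (toℕ i % 9 ≟ 0) ⊎-dec ((toℕ i % 3 ≟ 0) ×-dec (v₉ (toℕ i) ≟ 3)) ⊎-dec (v₉ (toℕ i) ≟ 0)))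
  per-factor : ∀ m → Supported 9 (factor (suc m) 0 (v₉ (suc m % 18)))
  per-factor m with classes (suc m % 18) (m%n<n (suc m) 18)
  ... | inj₁ r≡0 =
    factor-supported 9 m 0 (v₉ (suc m % 18)) (trans (sym (mod-18 9 (divides 2 refl) (suc m))) r≡0)
  ... | inj₂ (inj₁ (r≡0 , v≡3)) =
    supported-cong 9 (λ n → sym (trans (cong (λ e → factor (suc m) 0 e n) v≡3) (factor-frobenius m 0 1 n)))
                     (factor-supported 9 (ℕ.pred (3 * suc m)) 0 1 (n∣m⇒m%n≡0 _ 9 (*-monoʳ-∣ 3 3∣m+1)))
    where
    3∣m+1 : 3 ∣ suc m
    3∣m+1 = m%n≡0⇒n∣m (suc m) 3 (trans (sym (mod-18 3 (divides 6 refl) (suc m))) r≡0)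
  ... | inj₂ (inj₂ v≡0) =
    supported-cong 9 (λ n → sym (trans (cong (λ e → factor (suc m) 0 e n) v≡0) (factor-0-0 (suc m) n)))
                     (𝟙-supported 9)

c₂ : ℕ → ℕ
c₂ j = if isEven j then 4 else 2

-- K′ = 1 / (f₁² f₂²)
K′ : Series
K′ = Π (λ _ → 0) c₂

parity : ∀ j → (isEven j ≡ true × j % 2 ≡ 0) ⊎ (isEven j ≡ false × j % 2 ≡ 1)
parity zero          = inj₁ (refl , refl)
parity (suc zero)    = inj₂ (refl , refl)
parity (suc (suc j)) with parity j
... | inj₁ (even , j%2) = inj₁ (even , trans (cong (_% 2) (+-comm 2 j)) (trans ([m+n]%n≡m%n j 2) j%2))
... | inj₂ (odd  , j%2) = inj₂ (odd  , trans (cong (_% 2) (+-comm 2 j)) (trans ([m+n]%n≡m%n j 2) j%2))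

K′≈Θ²P₆ : K′ ≈ (Θ 1 1 ⊛ Θ 1 1) ⊛ P₆
K′≈Θ²P₆ = ≈-sym (begin
  (Θ 1 1 ⊛ Θ 1 1) ⊛ P₆
    ≈⟨ ⊛-cong (⊛-cong Θ-1-1 Θ-1-1) (≈-sym (Π-frobenius (λ _ → 0) (λ _ → 2))) ⟩
  (Π J₁₁ (λ _ → 0) ⊛ Π J₁₁ (λ _ → 0)) ⊛ Π (λ _ → 0) (λ _ → 6)
    ≈⟨ ⊛-congʳ (Π (λ _ → 0) (λ _ → 6)) (Π-⊛ J₁₁ (λ _ → 0) J₁₁ (λ _ → 0)) ⟩
  Π (λ j → J₁₁ j + J₁₁ j) (λ _ → 0) ⊛ Π (λ _ → 0) (λ _ → 6)
    ≈⟨ Π-⊛ (λ j → J₁₁ j + J₁₁ j) (λ _ → 0) (λ _ → 0) (λ _ → 6) ⟩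
  Π (λ j → J₁₁ j + J₁₁ j + 0) (λ _ → 6)
    ≈⟨ Π-cong (λ j → J₁₁ j + J₁₁ j + 0) (λ _ → 6) (λ _ → 0) c₂ (exponents ∘ suc) ⟩
  K′ ∎)
  where
  open ≈-Reasoning
  J₁₁ : ℕ → ℕ
  J₁₁ = jacobi-exponent 0 0
  exponents : ∀ j → J₁₁ j + J₁₁ j + 0 + c₂ j ≡ 0 + 6
  exponents j with parity j
  ... | inj₁ (even , j%2) rewrite even | j%2 = refl
  ... | inj₂ (odd  , j%2) rewrite odd  | j%2 = refl

K′-vanishesOn-7 : VanishesOn 9 7 K′
K′-vanishesOn-7 i i%9≡7 = trans (cong K′ (i≡7+q*9)) (vanishes (i / 9))
  where
  i≡7+q*9 : i ≡ 7 + i / 9 * 9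
  i≡7+q*9 = trans (m≡m%n+[m/n]*n i 9) (cong (_+ i / 9 * 9) i%9≡7)
  A Z : Series
  A = Θ 9 9
  Z = Θ 15 3
  residue₃ : ∀ r q → (r + q * 9) % 3 ≡ r % 3
  residue₃ r q = trans (cong (λ m → (r + m) % 3) (q*9≡[q*3]*3 q)) ([m+kn]%n≡m%n r (q * 3) 3)
    where
    q*9≡[q*3]*3 : ∀ q → q * 9 ≡ q * 3 * 3
    q*9≡[q*3]*3 = solve-∀
  vanishes : ∀ q → K′ (7 + q * 9) ≡ 0F
  vanishes q = begin
    K′ (7 + q * 9)
      ≡⟨ K′≈Θ²P₆ (7 + q * 9) ⟩
    ((Θ 1 1 ⊛ Θ 1 1) ⊛ P₆) (7 + q * 9)
      ≡⟨ ⊛-congʳ P₆ (⊛-cong Θ-1-1-dissection Θ-1-1-dissection) (7 + q * 9) ⟩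
    (((A ⊕ q^ 1 ⊛ Z) ⊛ (A ⊕ q^ 1 ⊛ Z)) ⊛ P₆) (7 + q * 9)
      ≡⟨ expand A (q^ 1) Z P₆ (7 + q * 9) ⟩
    ((A ⊛ A ⊛ P₆) ⊕ q^ 1 ⊛ (q^ 1 ⊛ (Z ⊛ Z ⊛ P₆)) ⊕ (xAZP ⊕ xAZP)) (7 + q * 9)
      ≡⟨ cong₂ _+F_ (cong₂ _+F_ no-A² no-Z²) (cong₂ _+F_ no-AZ no-AZ) ⟩
    0F ∎
    where
    open ≡-Reasoning
    xAZP : Series
    xAZP = q^ 1 ⊛ (A ⊛ (Z ⊛ P₆))
    expand : ∀ a x z p → ((a ⊕ x ⊛ z) ⊛ (a ⊕ x ⊛ z)) ⊛ p
                         ≈ (a ⊛ a ⊛ p) ⊕ x ⊛ (x ⊛ (z ⊛ z ⊛ p))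
                           ⊕ (x ⊛ (a ⊛ (z ⊛ p)) ⊕ x ⊛ (a ⊛ (z ⊛ p)))
    expand = solve 4 (λ a x z p → ((a :+ x :* z) :* (a :+ x :* z)) :* p
                                := (a :* a :* p) :+ x :* (x :* (z :* z :* p))
                                   :+ (x :* (a :* (z :* p)) :+ x :* (a :* (z :* p))))
                     (λ _ → refl)
    no-A² : (A ⊛ A ⊛ P₆) (7 + q * 9) ≡ 0F
    no-A² = ⊛-supported 3 (⊛-supported 3 A₃ A₃) P₆-supported (7 + q * 9)
                          (λ eq → contradiction (trans (sym (residue₃ 7 q)) eq) λ ())
      where
      A₃ : Supported 3 A
      A₃ = supported-∣ (divides 3 refl) Θ-9-9-supported
    no-Z² : (q^ 1 ⊛ (q^ 1 ⊛ (Z ⊛ Z ⊛ P₆))) (7 + q * 9) ≡ 0F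
    no-Z² = trans (q^⊛-+ 1 (q^ 1 ⊛ (Z ⊛ Z ⊛ P₆)) (6 + q * 9)) (trans (q^⊛-+ 1 (Z ⊛ Z ⊛ P₆) (5 + q * 9))
              (⊛-supported 3 (⊛-supported 3 Θ-15-3-supported Θ-15-3-supported) P₆-supported (5 + q * 9)
                             (λ eq → contradiction (trans (sym (residue₃ 5 q)) eq) λ ())))
    no-AZ : (q^ 1 ⊛ (A ⊛ (Z ⊛ P₆))) (7 + q * 9) ≡ 0F
    no-AZ = trans (q^⊛-+ 1 (A ⊛ (Z ⊛ P₆)) (6 + q * 9)) (trans (⊛-congˡ A Θ-15-3⊛P₆ (6 + q * 9))
              (trans (solve 3 (λ a t v → a :* (t :* v) := t :* (a :* v)) (λ _ → refl) A (Θ 3 3) V₉ (6 + q * 9))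
                     (⊛-vanishesOn 9 Θ-3-3-vanishesOn-6 (⊛-supported 9 Θ-9-9-supported V₉-supported)
                                   (6 + q * 9) ([m+kn]%n≡m%n 6 q 9))))

module Colours (K J : ℕ) where

  c₉ : ℕ → ℕ
  c₉ j = if isEven j then K ∸ J else K

  private
    9≡3*3 : ∀ x → 9 * x ≡ 3 * (3 * x)
    9≡3*3 = solve-∀

  colours-split : ∀ j → colours (9 * (K ∸ J) + 4) (9 * K + 2) j ≡ 3 * (3 * c₉ j) + c₂ j
  colours-split j with isEven j
  ... | true  = cong (_+ 4) (9≡3*3 (K ∸ J))
  ... | false = cong (_+ 2) (9≡3*3 K)

  H : Series
  H = Π (λ _ → 0) (λ j → 3 * (3 * c₉ j))

  H-supported : Supported 9 H
  H-supported = Π-supported 9 (λ _ → 0) (λ j → 3 * (3 * c₉ j)) λ m →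
    supported-cong 9 (λ n → sym (trans (factor-frobenius m 0 (3 * c₉ (suc m)) n)
                                       (factor-frobenius (ℕ.pred (3 * suc m)) 0 (c₉ (suc m)) n)))
                     (factor-supported 9 _ 0 (c₉ (suc m))
                       (n∣m⇒m%n≡0 _ 9 (divides (suc m) (trans (sym (9≡3*3 (suc m))) (*-comm 9 (suc m))))))

  generating-function : Π (λ _ → 0) (colours (9 * (K ∸ J) + 4) (9 * K + 2)) ≈ H ⊛ K′
  generating-function n = sym (trans (Π-⊛ (λ _ → 0) (λ j → 3 * (3 * c₉ j)) (λ _ → 0) c₂ n)
    (Π-cong (λ _ → 0) (λ j → 3 * (3 * c₉ j) + c₂ j) (λ _ → 0) (colours (9 * (K ∸ J) + 4) (9 * K + 2))
            (λ j → colours-split (suc j)) n))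

  coefficient-vanishes : ∀ n → Π (λ _ → 0) (colours (9 * (K ∸ J) + 4) (9 * K + 2)) (9 * n + 7) ≡ 0F
  coefficient-vanishes n = trans (generating-function (9 * n + 7)) (trans (⊛-comm H K′ (9 * n + 7))
    (⊛-vanishesOn 9 K′-vanishesOn-7 H-supported (9 * n + 7) residue))
    where
    residue : (9 * n + 7) % 9 ≡ 7
    residue = trans (cong (_% 9) (trans (+-comm (9 * n) 7) (cong (7 +_) (*-comm 9 n)))) ([m+kn]%n≡m%n 7 n 9)

theorem1p9 : ∀ (n k j : ℕ) → j ≤ k →
    3 ∣ a (9 * (k ∸ j) + 4) (9 * k + 2) (9 * n + 7)
theorem1p9 n k j _ = mod3≡0⇒3∣ _ (trans (a-mod3 _ _ (9 * n + 7)) (Colours.coefficient-vanishes k j n))
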